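{- Let $N\ge 2$ be an integer, and for $k\ge 2$ let $Q_j^{(k)}$ denote the quotient polynomial defined in the context. Then: (i) for $k\ge 4$, \[ Q_2^{(k)}(x) = \frac{(3k-1)(1+x^2) - 2(3k-5)\,x}{3k-1}; \] (ii) for $k\ge 5$, \[ Q_3^{(k)}(x) = -\frac{(x-1)\bigl(k x^2 - 2(k-4)x + k\bigr)}{k}. \]
   Context: Let $d_1,\ldots,d_k$ be independent and uniform on $\{0,\ldots,N-1\}$, and let $P$ be the $k\times k$ carry transition matrix $P[c,c'] = N^{ -k}\#\{(d_1,\ldots,d_k)\in\{0,\ldots,N-1\}^k : \lfloor (\sum_i d_i+c)/N\rfloor = c'\}$ on states $\{0,\ldots,k-1\}$ (row-stochastic). Its eigenvalues are $N^{ -j}$, $j=0,\ldots,k-1$, all simple. For each $j$, let $v_j$ be the right eigenvector ($Pv_j = N^{ -j}v_j$) normalized by $v_j[0]=1$. The quotient polynomial $Q_j^{(k)}$ is the polynomial (of degree $j$) satisfying $\sum_{i=0}^{k-1}\binom{k-1}{i}v_j[i]x^i = (1+x)^{k-1-j}Q_j^{(k)}(x)$; it does not depend on $N$. -}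

module Defs where

open import Data.Nat as ℕ using (ℕ; zero; suc; _≟_; NonZero)
open import Data.Nat.DivMod using () renaming (_/_ to _div_)
open import Data.Nat.Properties using (m^n≢0)
open import Data.Nat.Combinatorics using (_C_)
open import Data.Integer using (+_)
open import Data.Fin using (Fin; toℕ)
open import Data.Product using (_×_)
open import Data.Nat.ListAction using (sum)
open import Data.List as List using (List; []; _∷_; upTo; concatMap; filter; length)
open import Data.Rational as ℚ using (ℚ; _+_; _*_; _-_; -_; _/_)
open import Relation.Binary.PropositionalEquality using (_≡_)

ℕ→ℚ : ℕ → ℚ
ℕ→ℚ n = + n / 1

_^ℚ_ : ℚ → ℕ → ℚ
x ^ℚ zero  = ℚ.1ℚ
x ^ℚ suc n = x * (x ^ℚ n)

Σℚ : (n : ℕ) → (Fin n → ℚ) → ℚ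
Σℚ zero    f = ℚ.0ℚ
Σℚ (suc n) f = f Fin.zero + Σℚ n (λ i → f (Fin.suc i))

tuples : ℕ → ℕ → List (List ℕ)
tuples zero    N = [] ∷ []
tuples (suc k) N = concatMap (λ d → List.map (d ∷_) (tuples k N)) (upTo N)

carryCount : (N : ℕ) .{{_ : NonZero N}} → (k c c' : ℕ) → ℕ
carryCount N k c c' =
  length (filter (λ t → ((sum t ℕ.+ c) div N) ≟ c') (tuples k N))

invPow : (N : ℕ) .{{_ : NonZero N}} → ℕ → ℚ
invPow N j = _/_ (+ 1) (N ℕ.^ j) {{m^n≢0 N j}}

P : (N : ℕ) .{{_ : NonZero N}} → (k : ℕ) → Fin k → Fin k → ℚ
P N k c c' = ℕ→ℚ (carryCount N k (toℕ c) (toℕ c')) * invPow N k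

-- v is a right eigenvector of P for eigenvalue N^{-j}, normalised by v[0] = 1
-- (the state 0 exists since k = suc m)
IsNormEigen : (N : ℕ) .{{_ : NonZero N}} → (m j : ℕ) → (Fin (suc m) → ℚ) → Set
IsNormEigen N m j v =
  (v Fin.zero ≡ ℚ.1ℚ) ×
  (∀ c → Σℚ (suc m) (λ c' → P N (suc m) c c' * v c') ≡ invPow N j * v c)

genPoly : (k : ℕ) → (Fin k → ℚ) → ℚ → ℚ
genPoly k v x = Σℚ k (λ i → ℕ→ℚ ((k ℕ.∸ 1) C toℕ i) * v i * (x ^ℚ toℕ i))

-- Q₂^{(k)}(x) = ((3k-1)(1+x²) - 2(3k-5)x)/(3k-1);  1/(3k-1) written as 1/suc(3k-2), valid for k ≥ 1
Q2 : ℕ → ℚ → ℚ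
Q2 k x = (ℕ→ℚ (3 ℕ.* k ℕ.∸ 1) * (ℚ.1ℚ + x * x)
          - ℕ→ℚ 2 * (ℕ→ℚ (3 ℕ.* k) - ℕ→ℚ 5) * x)
         * (+ 1 / suc (3 ℕ.* k ℕ.∸ 2))

-- Q₃^{(k)}(x) = -((x-1)(k x² - 2(k-4)x + k))/k;  1/k written as 1/suc(k-1), valid for k ≥ 1
Q3 : ℕ → ℚ → ℚ
Q3 k x = - ((x - ℚ.1ℚ) * (ℕ→ℚ k * (x * x) - ℕ→ℚ 2 * (ℕ→ℚ k - ℕ→ℚ 4) * x + ℕ→ℚ k))
         * (+ 1 / suc (k ℕ.∸ 1))

{-# OPTIONS --safe #-}

-- Let carrySum k g c be the sum of g ⌊(d₁ + ⋯ + d_k + c) / N⌋ over all digit tuples, so that the carry matrix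
-- acts as (P v)(c) = N⁻ᵏ carrySum k v c.  Splitting off one digit gives
-- carrySum (k + 1) g c = Σ_{d < N} carrySum k g (d + c), hence Δ (carrySum (k + 1) g) = carrySum k (Δ g) for the
-- forward difference Δ.
--
-- For j ≤ 3 the eigenvectors vⱼ are explicit polynomials in the state, centred at (k - 1)/2.  For k = j,
-- vⱼ is the falling factorial q(q-1)⋯(q-j+1), which carrySum j fixes (both sides vanish at 0 and have the
-- same differences).  From k to k + 1, vⱼ(k + 1) is a combination of vⱼ(k), vⱼ₋₁(k), vⱼ₋₂(k), and summing a
-- cubic over N consecutive integers (Faulhaber) produces the extra factor N of the eigenvalue.
--
-- Uniqueness: for an eigenvector u with eigenvalue N^(k-j), the r-th differences of u on the states vanish
-- for every r ≠ j, from r = k downwards, because Δʳ turns the eigenvalue into N^(k-r).  So u is determined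
-- by Δʲu(0), i.e. it is a multiple of vⱼ.
--
-- Finally Σᵢ C(m,i) i(i-1)⋯(i-r+1) xⁱ = m(m-1)⋯(m-r+1) xʳ (1 + x)^(m-r) turns the cubic vⱼ into
-- (1 + x)^(k-4) times a cubic in x, which factors as vⱼ(0) (1 + x)^(3-j) Qⱼ.

module Submission where

open import Defs
open import Data.Nat using (ℕ; suc; _≤_; _∸_; NonZero)
open import Data.Product using (_×_; Σ)
open import Data.Fin using (Fin)
open import Data.Rational using (ℚ; 1ℚ; _+_; _*_)
open import Relation.Binary.PropositionalEquality using (_≡_)

open import Data.Bool.Base using (true; false; if_then_else_)
open import Data.Empty using (⊥-elim)
open import Data.Fin as Fin using (toℕ)
import Data.Fin.Properties as Fin
open import Data.Integer as ℤ using (+_)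
import Data.Integer.Properties as ℤ
import Data.Integer.Tactic.RingSolver as ℤ-Solver
open import Data.List as List using (List; []; _∷_)
import Data.List.Properties as List
open import Data.Maybe.Base using (Maybe; just; nothing)
open import Data.Nat as ℕ using (zero; _<_; s≤s; z≤n)
open import Data.Nat.Combinatorics using (_C_; nCk+nC[k+1]≡[n+1]C[k+1]; k>n⇒nCk≡0)
open import Data.Nat.DivMod using (m/n*n≤m; m/n≡1+[m∸n]/n) renaming (_/_ to _div_)
open import Data.Nat.ListAction using (sum)
import Data.Nat.Properties as ℕ
import Data.Nat.Tactic.RingSolver as ℕ-Solver
open import Data.Product using (_,_; proj₁; proj₂)
open import Data.Rational as ℚ using (0ℚ; _-_; -_; _/_; 1/_)
open import Data.Rational.Properties as ℚ using (+-*-commutativeRing)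
import Data.Rational.Unnormalised as ℚᵘ
import Data.Rational.Unnormalised.Properties as ℚᵘ
open import Data.Sum using (inj₁; inj₂)
open import Function.Base using (case_of_)
open import Level using (0ℓ)
open import Relation.Binary.Definitions using (tri<; tri≈; tri>)
open import Relation.Binary.PropositionalEquality using (refl; sym; trans; cong; cong₂; subst; _≢_; module ≡-Reasoning)
open import Relation.Nullary using (does; yes; no)
open import Tactic.RingSolver using (solve-∀)
import Tactic.RingSolver.Core.AlmostCommutativeRing as ACR

open import Algebra.Bundles using (CommutativeMonoid; CommutativeRing)
open import Algebra.Properties.CommutativeSemigroup (CommutativeMonoid.commutativeSemigroup ℚ.+-0-commutativeMonoid)
  using () renaming (interchange to +-interchange)
import Algebra.Properties.Semiring.Sum (CommutativeRing.semiring +-*-commutativeRing) as FinSum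

ℚ-ring : ACR.AlmostCommutativeRing 0ℓ 0ℓ
ℚ-ring = ACR.fromCommutativeRing +-*-commutativeRing isZero
  where
  isZero : ∀ x → Maybe (0ℚ ≡ x)
  isZero x with 0ℚ ℚ.≟ x
  ... | yes 0≡x = just 0≡x
  ... | no  _   = nothing

ℕ→ℚ-toℚᵘ : ∀ n → ℚ.toℚᵘ (ℕ→ℚ n) ℚᵘ.≃ ℚᵘ.mkℚᵘ (+ n) 0
ℕ→ℚ-toℚᵘ n = ℚ.toℚᵘ-fromℚᵘ (ℚᵘ.mkℚᵘ (+ n) 0)

ℕ→ℚ-+ : ∀ a b → ℕ→ℚ (a ℕ.+ b) ≡ ℕ→ℚ a + ℕ→ℚ b
ℕ→ℚ-+ a b = ℚ.toℚᵘ-injective (begin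
  ℚ.toℚᵘ (ℕ→ℚ (a ℕ.+ b))                  ≈⟨ ℕ→ℚ-toℚᵘ (a ℕ.+ b) ⟩
  ℚᵘ.mkℚᵘ (+ a ℤ.+ + b) 0               ≈⟨ ℚᵘ.*≡* (identity (+ a) (+ b)) ⟩
  ℚᵘ.mkℚᵘ (+ a) 0 ℚᵘ.+ ℚᵘ.mkℚᵘ (+ b) 0     ≈⟨ ℚᵘ.+-cong (ℕ→ℚ-toℚᵘ a) (ℕ→ℚ-toℚᵘ b) ⟨
  ℚ.toℚᵘ (ℕ→ℚ a) ℚᵘ.+ ℚ.toℚᵘ (ℕ→ℚ b)      ≈⟨ ℚ.toℚᵘ-homo-+ (ℕ→ℚ a) (ℕ→ℚ b) ⟨
  ℚ.toℚᵘ (ℕ→ℚ a + ℕ→ℚ b)                  ∎)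
  where
  open ℚᵘ.≃-Reasoning
  identity : ∀ p q → (p ℤ.+ q) ℤ.* (+ 1 ℤ.* + 1) ≡ (p ℤ.* + 1 ℤ.+ q ℤ.* + 1) ℤ.* + 1
  identity = ℤ-Solver.solve-∀

ℕ→ℚ-* : ∀ a b → ℕ→ℚ (a ℕ.* b) ≡ ℕ→ℚ a * ℕ→ℚ b
ℕ→ℚ-* a b = ℚ.toℚᵘ-injective (begin
  ℚ.toℚᵘ (ℕ→ℚ (a ℕ.* b))                  ≈⟨ ℕ→ℚ-toℚᵘ (a ℕ.* b) ⟩
  ℚᵘ.mkℚᵘ (+ (a ℕ.* b)) 0                   ≡⟨ cong (λ z → ℚᵘ.mkℚᵘ z 0) (ℤ.pos-* a b) ⟩
  ℚᵘ.mkℚᵘ (+ a ℤ.* + b) 0                   ≈⟨ ℚᵘ.*≡* (identity (+ a) (+ b)) ⟩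
  ℚᵘ.mkℚᵘ (+ a) 0 ℚᵘ.* ℚᵘ.mkℚᵘ (+ b) 0     ≈⟨ ℚᵘ.*-cong (ℕ→ℚ-toℚᵘ a) (ℕ→ℚ-toℚᵘ b) ⟨
  ℚ.toℚᵘ (ℕ→ℚ a) ℚᵘ.* ℚ.toℚᵘ (ℕ→ℚ b)      ≈⟨ ℚ.toℚᵘ-homo-* (ℕ→ℚ a) (ℕ→ℚ b) ⟨
  ℚ.toℚᵘ (ℕ→ℚ a * ℕ→ℚ b)                  ∎)
  where
  open ℚᵘ.≃-Reasoning
  identity : ∀ p q → (p ℤ.* q) ℤ.* (+ 1 ℤ.* + 1) ≡ (p ℤ.* q) ℤ.* + 1
  identity = ℤ-Solver.solve-∀

ℕ→ℚ-suc : ∀ n → ℕ→ℚ (suc n) ≡ 1ℚ + ℕ→ℚ n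
ℕ→ℚ-suc = ℕ→ℚ-+ 1

ℕ→ℚ-affine : ∀ a b n → ℕ→ℚ (a ℕ.+ b ℕ.* n) ≡ ℕ→ℚ a + ℕ→ℚ b * ℕ→ℚ n
ℕ→ℚ-affine a b n = trans (ℕ→ℚ-+ a (b ℕ.* n)) (cong (_+_ (ℕ→ℚ a)) (ℕ→ℚ-* b n))

3*[1+m]≡3+3*m : ∀ m → 3 ℕ.* suc m ≡ 3 ℕ.+ 3 ℕ.* m
3*[1+m]≡3+3*m = ℕ-Solver.solve-∀

ℕ→ℚ-^ : ∀ N e → ℕ→ℚ (N ℕ.^ e) ≡ ℕ→ℚ N ^ℚ e
ℕ→ℚ-^ N zero    = refl
ℕ→ℚ-^ N (suc e) = trans (ℕ→ℚ-* N (N ℕ.^ e)) (cong (ℕ→ℚ N *_) (ℕ→ℚ-^ N e))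

ℕ→ℚ-injective : ∀ {a b} → ℕ→ℚ a ≡ ℕ→ℚ b → a ≡ b
ℕ→ℚ-injective {a} {b} eq with ℚ.fromℚᵘ-injective {ℚᵘ.mkℚᵘ (+ a) 0} {ℚᵘ.mkℚᵘ (+ b) 0} eq
... | ℚᵘ.*≡* a*1≡b*1 = ℤ.+-injective (begin
  + a          ≡⟨ ℤ.*-identityʳ (+ a) ⟨
  + a ℤ.* + 1  ≡⟨ a*1≡b*1 ⟩
  + b ℤ.* + 1  ≡⟨ ℤ.*-identityʳ (+ b) ⟩
  + b          ∎)
  where open ≡-Reasoning

^ℚ-+ : ∀ x a b → x ^ℚ (a ℕ.+ b) ≡ x ^ℚ a * x ^ℚ b
^ℚ-+ x zero    b = sym (ℚ.*-identityˡ (x ^ℚ b))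
^ℚ-+ x (suc a) b = trans (cong (x *_) (^ℚ-+ x a b)) (sym (ℚ.*-assoc x (x ^ℚ a) (x ^ℚ b)))

^-injective : ∀ {N} → 1 < N → ∀ {a b} → N ℕ.^ a ≡ N ℕ.^ b → a ≡ b
^-injective {N} 1<N {a} {b} Nᵃ≡Nᵇ with ℕ.<-cmp a b
... | tri< a<b _ _ = ⊥-elim (ℕ.<-irrefl Nᵃ≡Nᵇ (ℕ.^-monoʳ-< N 1<N a<b))
... | tri≈ _ a≡b _ = a≡b
... | tri> _ _ b<a = ⊥-elim (ℕ.<-irrefl (sym Nᵃ≡Nᵇ) (ℕ.^-monoʳ-< N 1<N b<a))

^ℚ-injective : ∀ {N} → 1 < N → ∀ {a b} → ℕ→ℚ N ^ℚ a ≡ ℕ→ℚ N ^ℚ b → a ≡ b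
^ℚ-injective {N} 1<N {a} {b} Nᵃ≡Nᵇ =
  ^-injective 1<N (ℕ→ℚ-injective (trans (ℕ→ℚ-^ N a) (trans Nᵃ≡Nᵇ (sym (ℕ→ℚ-^ N b)))))

1/n*n≡1 : ∀ n .{{_ : NonZero n}} → (+ 1 / n) * ℕ→ℚ n ≡ 1ℚ
1/n*n≡1 n@(suc n-1) = ℚ.toℚᵘ-injective (begin
  ℚ.toℚᵘ ((+ 1 / n) * ℕ→ℚ n)                   ≈⟨ ℚ.toℚᵘ-homo-* (+ 1 / n) (ℕ→ℚ n) ⟩
  ℚ.toℚᵘ (+ 1 / n) ℚᵘ.* ℚ.toℚᵘ (ℕ→ℚ n)        ≈⟨ ℚᵘ.*-cong (ℚ.toℚᵘ-fromℚᵘ (ℚᵘ.mkℚᵘ (+ 1) n-1)) (ℕ→ℚ-toℚᵘ n) ⟩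
  ℚᵘ.mkℚᵘ (+ 1) n-1 ℚᵘ.* ℚᵘ.mkℚᵘ (+ n) 0       ≈⟨ ℚᵘ.*≡* (identity (+ n)) ⟩
  ℚ.toℚᵘ 1ℚ                                     ∎)
  where
  open ℚᵘ.≃-Reasoning
  identity : ∀ p → (+ 1 ℤ.* p) ℤ.* + 1 ≡ + 1 ℤ.* (p ℤ.* + 1)
  identity = ℤ-Solver.solve-∀

x*a≡y*a∧x≢y⇒a≡0 : ∀ x y a → x * a ≡ y * a → x ≢ y → a ≡ 0ℚ
x*a≡y*a∧x≢y⇒a≡0 x y a xa≡ya x≢y with a ℚ.≟ 0ℚ
... | yes a≡0 = a≡0
... | no  a≢0 = ⊥-elim (x≢y (begin
  x                ≡⟨ z≡z*a*a⁻¹ x ⟩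
  x * a * (1/ a)   ≡⟨ cong (_* (1/ a)) xa≡ya ⟩
  y * a * (1/ a)   ≡⟨ z≡z*a*a⁻¹ y ⟨
  y                ∎))
  where
  open ≡-Reasoning
  instance
    a≢0′ : ℚ.NonZero a
    a≢0′ = ℚ.≢-nonZero a≢0
  z≡z*a*a⁻¹ : ∀ z → z ≡ z * a * (1/ a)
  z≡z*a*a⁻¹ z = begin
    z                ≡⟨ ℚ.*-identityʳ z ⟨
    z * 1ℚ           ≡⟨ cong (z *_) (ℚ.*-inverseʳ a) ⟨
    z * (a * 1/ a)   ≡⟨ ℚ.*-assoc z a (1/ a) ⟨
    z * a * (1/ a)   ∎

y≡x+[y-x] : ∀ x y → y ≡ x + (y - x)
y≡x+[y-x] = solve-∀ ℚ-ring

*-unitʳ : ∀ {x y} u → u ≡ 1ℚ → x * u ≡ y → x ≡ y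
*-unitʳ {x} u refl xu≡y = trans (sym (ℚ.*-identityʳ x)) xu≡y

½ : ℚ
½ = + 1 / 2

⅓ : ℚ
⅓ = + 1 / 3

∑ : ℕ → (ℕ → ℚ) → ℚ
∑ zero    f = 0ℚ
∑ (suc n) f = f 0 + ∑ n (λ i → f (suc i))

syntax ∑ n (λ i → e) = ∑[ i < n ] e

∑-cong : ∀ n {f g : ℕ → ℚ} → (∀ i → i < n → f i ≡ g i) → ∑ n f ≡ ∑ n g
∑-cong zero    f≡g = refl
∑-cong (suc n) f≡g = cong₂ _+_ (f≡g 0 (s≤s z≤n)) (∑-cong n (λ i i<n → f≡g (suc i) (s≤s i<n)))

∑-+ : ∀ n (f g : ℕ → ℚ) → ∑[ i < n ] (f i + g i) ≡ ∑ n f + ∑ n g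
∑-+ zero    f g = sym (ℚ.+-identityˡ 0ℚ)
∑-+ (suc n) f g =
  trans (cong (_+_ (f 0 + g 0)) (∑-+ n (λ i → f (suc i)) (λ i → g (suc i))))
        (+-interchange (f 0) (g 0) (∑[ i < n ] f (suc i)) (∑[ i < n ] g (suc i)))

∑-scale : ∀ n a (f : ℕ → ℚ) → ∑[ i < n ] (a * f i) ≡ a * ∑ n f
∑-scale zero    a f = sym (ℚ.*-zeroʳ a)
∑-scale (suc n) a f =
  trans (cong (_+_ (a * f 0)) (∑-scale n a (λ i → f (suc i)))) (sym (ℚ.*-distribˡ-+ a (f 0) _))

∑-const : ∀ n a → ∑[ i < n ] a ≡ ℕ→ℚ n * a
∑-const zero    a = sym (ℚ.*-zeroˡ a)
∑-const (suc n) a = begin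
  a + ∑[ i < n ] a      ≡⟨ cong (_+_ a) (∑-const n a) ⟩
  a + ℕ→ℚ n * a         ≡⟨ distrib a (ℕ→ℚ n) ⟩
  (1ℚ + ℕ→ℚ n) * a      ≡⟨ cong (_* a) (ℕ→ℚ-suc n) ⟨
  ℕ→ℚ (suc n) * a       ∎
  where
  open ≡-Reasoning
  distrib : ∀ a x → a + x * a ≡ (1ℚ + x) * a
  distrib = solve-∀ ℚ-ring

∑-telescope : ∀ n (f : ℕ → ℚ) → ∑[ i < n ] f (suc i) - ∑ n f ≡ f n - f 0
∑-telescope zero    f = sym (ℚ.+-inverseʳ (f 0))
∑-telescope (suc n) f =
  trans (regroup (f 0) (f 1) (∑[ i < n ] f (suc (suc i))) (∑[ i < n ] f (suc i)))
        (trans (cong (_+_ (f 1 - f 0)) (∑-telescope n (λ i → f (suc i))))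
               (cancel (f 0) (f 1) (f (suc n))))
  where
  regroup : ∀ x y X Y → y + X - (x + Y) ≡ y - x + (X - Y)
  regroup = solve-∀ ℚ-ring
  cancel : ∀ x y z → y - x + (z - y) ≡ z - x
  cancel = solve-∀ ℚ-ring

∑-snoc : ∀ n f → ∑ (suc n) f ≡ ∑ n f + f n
∑-snoc zero    f = trans (ℚ.+-identityʳ (f 0)) (sym (ℚ.+-identityˡ (f 0)))
∑-snoc (suc n) f = trans (cong (_+_ (f 0)) (∑-snoc n (λ i → f (suc i)))) (sym (ℚ.+-assoc (f 0) _ _))

cubic : ℚ → ℚ → ℚ → ℚ → ℚ → ℚ
cubic a b c e y = a + b * y + c * (y * y) + e * (y * y * y)

-- Faulhaber: ∑ d = S₁, ∑ d² = S₁ (2μ - 1) / 3 and ∑ d³ = S₁², combined through the Taylor expansion at y.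
cubicWindowSum : ℚ → ℚ → ℚ → ℚ → ℚ → ℚ → ℚ
cubicWindowSum μ a b c e y =
  μ * cubic a b c e y + S₁ * (b + ℕ→ℚ 2 * c * y + ℕ→ℚ 3 * e * (y * y))
  + S₁ * (ℕ→ℚ 2 * μ - 1ℚ) * ⅓ * (c + ℕ→ℚ 3 * e * y) + S₁ * S₁ * e
  where
  S₁ : ℚ
  S₁ = μ * (μ - 1ℚ) * ½

∑-cubic : ∀ M a b c e y → ∑[ d < M ] cubic a b c e (ℕ→ℚ d + y) ≡ cubicWindowSum (ℕ→ℚ M) a b c e y
∑-cubic zero    a b c e y = empty a b c e y
  where
  empty : ∀ a b c e y →
    let p z = a + b * z + c * (z * z) + e * (z * z * z)
        W μ y = μ * p y + μ * (μ - 1ℚ) * ½ * (b + ℕ→ℚ 2 * c * y + ℕ→ℚ 3 * e * (y * y))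
            + μ * (μ - 1ℚ) * ½ * (ℕ→ℚ 2 * μ - 1ℚ) * ⅓ * (c + ℕ→ℚ 3 * e * y)
            + μ * (μ - 1ℚ) * ½ * (μ * (μ - 1ℚ) * ½) * e
    in 0ℚ ≡ W (ℕ→ℚ 0) y
  empty = solve-∀ ℚ-ring
∑-cubic (suc M) a b c e y = begin
  cubic a b c e (ℕ→ℚ 0 + y) + ∑[ d < M ] cubic a b c e (ℕ→ℚ (suc d) + y)
    ≡⟨ cong (_+_ (cubic a b c e (ℕ→ℚ 0 + y))) (∑-cong M λ d _ → cong (cubic a b c e) (shift d)) ⟩
  cubic a b c e (ℕ→ℚ 0 + y) + ∑[ d < M ] cubic a b c e (ℕ→ℚ d + (1ℚ + y))
    ≡⟨ cong (_+_ (cubic a b c e (ℕ→ℚ 0 + y))) (∑-cubic M a b c e (1ℚ + y)) ⟩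
  cubic a b c e (ℕ→ℚ 0 + y) + cubicWindowSum (ℕ→ℚ M) a b c e (1ℚ + y) ≡⟨ step a b c e y (ℕ→ℚ M) ⟩
  cubicWindowSum (1ℚ + ℕ→ℚ M) a b c e y ≡⟨ cong (λ μ → cubicWindowSum μ a b c e y) (ℕ→ℚ-suc M) ⟨
  cubicWindowSum (ℕ→ℚ (suc M)) a b c e y ∎
  where
  open ≡-Reasoning
  shift : ∀ d → ℕ→ℚ (suc d) + y ≡ ℕ→ℚ d + (1ℚ + y)
  shift d = trans (cong (_+ y) (trans (ℕ→ℚ-suc d) (ℚ.+-comm 1ℚ (ℕ→ℚ d)))) (ℚ.+-assoc (ℕ→ℚ d) 1ℚ y)
  step : ∀ a b c e y μ →
    let p z = a + b * z + c * (z * z) + e * (z * z * z)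
        W μ y = μ * p y + μ * (μ - 1ℚ) * ½ * (b + ℕ→ℚ 2 * c * y + ℕ→ℚ 3 * e * (y * y))
            + μ * (μ - 1ℚ) * ½ * (ℕ→ℚ 2 * μ - 1ℚ) * ⅓ * (c + ℕ→ℚ 3 * e * y)
            + μ * (μ - 1ℚ) * ½ * (μ * (μ - 1ℚ) * ½) * e
    in p (ℕ→ℚ 0 + y) + W μ (1ℚ + y) ≡ W (1ℚ + μ) y
  step = solve-∀ ℚ-ring

Σℚ-∑ : ∀ n (f : ℕ → ℚ) → Σℚ n (λ i → f (toℕ i)) ≡ ∑ n f
Σℚ-∑ zero    f = refl
Σℚ-∑ (suc n) f = cong (_+_ (f 0)) (Σℚ-∑ n (λ i → f (suc i)))

Σℚ-sum : ∀ n f → Σℚ n f ≡ FinSum.sum f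
Σℚ-sum zero    f = refl
Σℚ-sum (suc n) f = cong (_+_ (f Fin.zero)) (Σℚ-sum n (λ i → f (Fin.suc i)))

Σℚ-cong : ∀ n {f g : Fin n → ℚ} → (∀ i → f i ≡ g i) → Σℚ n f ≡ Σℚ n g
Σℚ-cong n {f} {g} f≗g = trans (Σℚ-sum n f) (trans (FinSum.sum-cong-≗ f≗g) (sym (Σℚ-sum n g)))

Σℚ-+ : ∀ n (f g : Fin n → ℚ) → Σℚ n (λ i → f i + g i) ≡ Σℚ n f + Σℚ n g
Σℚ-+ n f g = trans (Σℚ-sum n _) (trans (FinSum.∑-distrib-+ f g) (sym (cong₂ _+_ (Σℚ-sum n f) (Σℚ-sum n g))))

Σℚ-scale : ∀ n a (f : Fin n → ℚ) → Σℚ n (λ i → a * f i) ≡ a * Σℚ n f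
Σℚ-scale n a f = trans (Σℚ-sum n _) (sym (trans (cong (a *_) (Σℚ-sum n f)) (FinSum.*-distribˡ-sum a f)))

Σℚ-zero : ∀ n → Σℚ n (λ _ → 0ℚ) ≡ 0ℚ
Σℚ-zero n = trans (Σℚ-sum n _) (FinSum.sum-replicate-zero n)

extend : ∀ k → (Fin k → ℚ) → ℕ → ℚ
extend zero    v q       = 0ℚ
extend (suc k) v zero    = v Fin.zero
extend (suc k) v (suc q) = extend k (λ i → v (Fin.suc i)) q

extend-toℕ : ∀ k (v : Fin k → ℚ) i → extend k v (toℕ i) ≡ v i
extend-toℕ (suc k) v Fin.zero    = refl
extend-toℕ (suc k) v (Fin.suc i) = extend-toℕ k (λ i → v (Fin.suc i)) i

extend-restrict : ∀ k (f : ℕ → ℚ) q → q < k → extend k (λ i → f (toℕ i)) q ≡ f q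
extend-restrict (suc k) f zero    _         = refl
extend-restrict (suc k) f (suc q) (s≤s q<k) = extend-restrict k (λ i → f (suc i)) q q<k

indicator : ℕ → ℕ → ℚ
indicator q i = if does (q ℕ.≟ i) then 1ℚ else 0ℚ

Σℚ-indicator : ∀ k (v : Fin k → ℚ) q → Σℚ k (λ i → indicator q (toℕ i) * v i) ≡ extend k v q
Σℚ-indicator zero    v q       = refl
Σℚ-indicator (suc k) v zero    = begin
  1ℚ * v Fin.zero + Σℚ k (λ i → 0ℚ * v (Fin.suc i))  ≡⟨ cong₂ _+_ (ℚ.*-identityˡ (v Fin.zero)) (Σℚ-cong k (λ i → ℚ.*-zeroˡ (v (Fin.suc i)))) ⟩
  v Fin.zero + Σℚ k (λ _ → 0ℚ)                       ≡⟨ cong (_+_ (v Fin.zero)) (Σℚ-zero k) ⟩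
  v Fin.zero + 0ℚ                                   ≡⟨ ℚ.+-identityʳ _ ⟩
  v Fin.zero                                        ∎
  where open ≡-Reasoning
Σℚ-indicator (suc k) v (suc q) =
  trans (cong₂ _+_ (ℚ.*-zeroˡ (v Fin.zero)) (Σℚ-indicator k (λ i → v (Fin.suc i)) q)) (ℚ.+-identityˡ _)

sumL : List ℚ → ℚ
sumL = List.foldr _+_ 0ℚ

sumL-++ : ∀ xs ys → sumL (xs List.++ ys) ≡ sumL xs + sumL ys
sumL-++ []       ys = sym (ℚ.+-identityˡ (sumL ys))
sumL-++ (x ∷ xs) ys = trans (cong (_+_ x) (sumL-++ xs ys)) (sym (ℚ.+-assoc x (sumL xs) (sumL ys)))

sumL-concatMap : ∀ {A B : Set} (F : B → ℚ) (G : A → List B) xs →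
                 sumL (List.map F (List.concatMap G xs)) ≡ sumL (List.map (λ x → sumL (List.map F (G x))) xs)
sumL-concatMap F G []       = refl
sumL-concatMap F G (x ∷ xs) = begin
  sumL (List.map F (G x List.++ List.concatMap G xs))                  ≡⟨ cong sumL (List.map-++ F (G x) _) ⟩
  sumL (List.map F (G x) List.++ List.map F (List.concatMap G xs))     ≡⟨ sumL-++ (List.map F (G x)) _ ⟩
  sumL (List.map F (G x)) + sumL (List.map F (List.concatMap G xs))    ≡⟨ cong (_+_ (sumL (List.map F (G x)))) (sumL-concatMap F G xs) ⟩
  sumL (List.map F (G x)) + sumL (List.map (λ x → sumL (List.map F (G x))) xs) ∎
  where open ≡-Reasoning

sumL-applyUpTo : ∀ n (f : ℕ → ℕ) (h : ℕ → ℚ) → sumL (List.map h (List.applyUpTo f n)) ≡ ∑[ i < n ] h (f i)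
sumL-applyUpTo zero    f h = refl
sumL-applyUpTo (suc n) f h = cong (_+_ (h (f 0))) (sumL-applyUpTo n (λ i → f (suc i)) h)

Σℚ-count : ∀ {A : Set} k (v : Fin k → ℚ) (f : A → ℕ) ts →
           Σℚ k (λ i → ℕ→ℚ (List.length (List.filter (λ t → f t ℕ.≟ toℕ i) ts)) * v i)
           ≡ sumL (List.map (λ t → extend k v (f t)) ts)
Σℚ-count k v f []       = trans (Σℚ-cong k (λ i → ℚ.*-zeroˡ (v i))) (Σℚ-zero k)
Σℚ-count k v f (t ∷ ts) = begin
  Σℚ k (λ i → ℕ→ℚ (count (t ∷ ts) i) * v i)
    ≡⟨ Σℚ-cong k (λ i → trans (cong (_* v i) (count-∷ i)) (ℚ.*-distribʳ-+ (v i) (indicator (f t) (toℕ i)) (ℕ→ℚ (count ts i)))) ⟩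
  Σℚ k (λ i → indicator (f t) (toℕ i) * v i + ℕ→ℚ (count ts i) * v i)
    ≡⟨ Σℚ-+ k _ _ ⟩
  Σℚ k (λ i → indicator (f t) (toℕ i) * v i) + Σℚ k (λ i → ℕ→ℚ (count ts i) * v i)
    ≡⟨ cong₂ _+_ (Σℚ-indicator k v (f t)) (Σℚ-count k v f ts) ⟩
  extend k v (f t) + sumL (List.map (λ t → extend k v (f t)) ts) ∎
  where
  open ≡-Reasoning
  count : List _ → Fin k → ℕ
  count ts i = List.length (List.filter (λ t → f t ℕ.≟ toℕ i) ts)
  count-∷ : ∀ i → ℕ→ℚ (count (t ∷ ts) i) ≡ indicator (f t) (toℕ i) + ℕ→ℚ (count ts i)
  count-∷ i with does (f t ℕ.≟ toℕ i)
  ... | true  = ℕ→ℚ-suc (count ts i)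
  ... | false = sym (ℚ.+-identityˡ _)

Δ : (ℕ → ℚ) → ℕ → ℚ
Δ f c = f (suc c) - f c

Δⁿ : ℕ → (ℕ → ℚ) → ℕ → ℚ
Δⁿ zero    f = f
Δⁿ (suc r) f = Δⁿ r (Δ f)

Δⁿ-cong : ∀ r {f g : ℕ → ℚ} → (∀ c → f c ≡ g c) → ∀ c → Δⁿ r f c ≡ Δⁿ r g c
Δⁿ-cong zero    f≡g = f≡g
Δⁿ-cong (suc r) f≡g = Δⁿ-cong r (λ c → cong₂ _-_ (f≡g (suc c)) (f≡g c))

Δⁿ-suc : ∀ r f c → Δⁿ (suc r) f c ≡ Δ (Δⁿ r f) c
Δⁿ-suc zero    f c = refl
Δⁿ-suc (suc r) f c = Δⁿ-suc r (Δ f) c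

Δⁿ-constant : ∀ r k u → (∀ c → c ℕ.+ suc r < k → Δⁿ (suc r) u c ≡ 0ℚ) → ∀ c → c ℕ.+ r < k → Δⁿ r u c ≡ Δⁿ r u 0
Δⁿ-constant r k u Δʳ⁺¹u≡0 zero    _       = refl
Δⁿ-constant r k u Δʳ⁺¹u≡0 (suc c) 1+c+r<k = begin
  Δⁿ r u (suc c)              ≡⟨ y≡x+[y-x] (Δⁿ r u c) (Δⁿ r u (suc c)) ⟩
  Δⁿ r u c + Δ (Δⁿ r u) c     ≡⟨ cong₂ _+_ (Δⁿ-constant r k u Δʳ⁺¹u≡0 c (ℕ.<-trans (ℕ.n<1+n _) 1+c+r<k)) (sym (Δⁿ-suc r u c)) ⟩
  Δⁿ r u 0 + Δⁿ (suc r) u c   ≡⟨ cong (_+_ (Δⁿ r u 0)) (Δʳ⁺¹u≡0 c (subst (_< k) (sym (ℕ.+-suc c r)) 1+c+r<k)) ⟩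
  Δⁿ r u 0 + 0ℚ               ≡⟨ ℚ.+-identityʳ (Δⁿ r u 0) ⟩
  Δⁿ r u 0                    ∎
  where open ≡-Reasoning

Δⁿ-local : ∀ r {f g : ℕ → ℚ} → (∀ c → c ≤ r → f c ≡ g c) → Δⁿ r f 0 ≡ Δⁿ r g 0
Δⁿ-local zero    f≡g = f≡g 0 z≤n
Δⁿ-local (suc r) f≡g =
  Δⁿ-local r (λ c c≤r → cong₂ _-_ (f≡g (suc c) (s≤s c≤r)) (f≡g c (ℕ.m≤n⇒m≤1+n c≤r)))

Δⁿ-lin : ∀ r a (f g : ℕ → ℚ) c → Δⁿ r (λ x → f x + a * g x) c ≡ Δⁿ r f c + a * Δⁿ r g c
Δⁿ-lin zero    a f g c = refl
Δⁿ-lin (suc r) a f g c =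
  trans (Δⁿ-cong r (λ x → regroup (f (suc x)) (f x) (g (suc x)) (g x) a) c) (Δⁿ-lin r a (Δ f) (Δ g) c)
  where
  regroup : ∀ x y u v a → x + a * u - (y + a * v) ≡ x - y + a * (u - v)
  regroup = solve-∀ ℚ-ring

Δⁿ-scale : ∀ r a (f : ℕ → ℚ) c → Δⁿ r (λ x → a * f x) c ≡ a * Δⁿ r f c
Δⁿ-scale zero    a f c = refl
Δⁿ-scale (suc r) a f c =
  trans (Δⁿ-cong r (λ x → factor a (f (suc x)) (f x)) c) (Δⁿ-scale r a (Δ f) c)
  where
  factor : ∀ a x y → a * x - a * y ≡ a * (x - y)
  factor = solve-∀ ℚ-ring

Δ-injective : ∀ {f g : ℕ → ℚ} → f 0 ≡ g 0 → (∀ c → Δ f c ≡ Δ g c) → ∀ c → f c ≡ g c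
Δ-injective f0≡g0 Δf≡Δg zero    = f0≡g0
Δ-injective {f} {g} f0≡g0 Δf≡Δg (suc c) = begin
  f (suc c)             ≡⟨ y≡x+[y-x] (f c) (f (suc c)) ⟩
  f c + Δ f c           ≡⟨ cong₂ _+_ (Δ-injective {f} {g} f0≡g0 Δf≡Δg c) (Δf≡Δg c) ⟩
  g c + Δ g c           ≡⟨ y≡x+[y-x] (g c) (g (suc c)) ⟨
  g (suc c)             ∎
  where
  open ≡-Reasoning

fallingFactorial : ℕ → ℕ → ℚ
fallingFactorial zero    q = 1ℚ
fallingFactorial (suc j) q = fallingFactorial j q * (ℕ→ℚ q - ℕ→ℚ j)

fallingFactorial-vanishes : ∀ j q → q < j → fallingFactorial j q ≡ 0ℚ
fallingFactorial-vanishes (suc j) q q<1+j with ℕ.m<1+n⇒m<n∨m≡n q<1+j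
... | inj₁ q<j  = trans (cong (_* (ℕ→ℚ q - ℕ→ℚ j)) (fallingFactorial-vanishes j q q<j)) (ℚ.*-zeroˡ (ℕ→ℚ q - ℕ→ℚ j))
... | inj₂ refl = trans (cong (fallingFactorial j q *_) (ℚ.+-inverseʳ (ℕ→ℚ q))) (ℚ.*-zeroʳ (fallingFactorial j q))

Δ-fallingFactorial : ∀ j q → Δ (fallingFactorial (suc j)) q ≡ ℕ→ℚ (suc j) * fallingFactorial j q
Δ-fallingFactorial zero    q = begin
  1ℚ * (ℕ→ℚ (suc q) - ℕ→ℚ 0) - 1ℚ * (ℕ→ℚ q - ℕ→ℚ 0)   ≡⟨ cong (λ y → 1ℚ * (y - ℕ→ℚ 0) - 1ℚ * (ℕ→ℚ q - ℕ→ℚ 0)) (ℕ→ℚ-suc q) ⟩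
  1ℚ * ((1ℚ + ℕ→ℚ q) - ℕ→ℚ 0) - 1ℚ * (ℕ→ℚ q - ℕ→ℚ 0) ≡⟨ simplify (ℕ→ℚ q) ⟩
  ℕ→ℚ 1 * 1ℚ                                          ∎
  where
  open ≡-Reasoning
  simplify : ∀ x → 1ℚ * ((1ℚ + x) - ℕ→ℚ 0) - 1ℚ * (x - ℕ→ℚ 0) ≡ ℕ→ℚ 1 * 1ℚ
  simplify = solve-∀ ℚ-ring
Δ-fallingFactorial (suc j) q = begin
  A * (ℕ→ℚ (suc q) - ℕ→ℚ (suc j)) - B * (ℕ→ℚ q - ℕ→ℚ (suc j))
    ≡⟨ cong₂ (λ y i → A * (y - i) - B * (ℕ→ℚ q - i)) (ℕ→ℚ-suc q) (ℕ→ℚ-suc j) ⟩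
  A * ((1ℚ + ℕ→ℚ q) - (1ℚ + ℕ→ℚ j)) - B * (ℕ→ℚ q - (1ℚ + ℕ→ℚ j))
    ≡⟨ cong (λ a → a * ((1ℚ + ℕ→ℚ q) - (1ℚ + ℕ→ℚ j)) - B * (ℕ→ℚ q - (1ℚ + ℕ→ℚ j))) A≡B+ΔB ⟩
  (B + ℕ→ℚ (suc j) * F) * ((1ℚ + ℕ→ℚ q) - (1ℚ + ℕ→ℚ j)) - B * (ℕ→ℚ q - (1ℚ + ℕ→ℚ j))
    ≡⟨ cong (λ i → (B + i * F) * ((1ℚ + ℕ→ℚ q) - (1ℚ + ℕ→ℚ j)) - B * (ℕ→ℚ q - (1ℚ + ℕ→ℚ j))) (ℕ→ℚ-suc j) ⟩
  _ ≡⟨ simplify F (ℕ→ℚ q) (ℕ→ℚ j) ⟩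
  (1ℚ + (1ℚ + ℕ→ℚ j)) * B
    ≡⟨ cong (_* B) (trans (ℕ→ℚ-suc (suc j)) (cong (_+_ 1ℚ) (ℕ→ℚ-suc j))) ⟨
  ℕ→ℚ (suc (suc j)) * B ∎
  where
  open ≡-Reasoning
  F B A : ℚ
  F = fallingFactorial j q
  B = fallingFactorial (suc j) q
  A = fallingFactorial (suc j) (suc q)
  A≡B+ΔB : A ≡ B + ℕ→ℚ (suc j) * F
  A≡B+ΔB = trans (y≡x+[y-x] B A) (cong (_+_ B) (Δ-fallingFactorial j q))
  simplify : ∀ F x i →
    (F * (x - i) + (1ℚ + i) * F) * ((1ℚ + x) - (1ℚ + i)) - F * (x - i) * (x - (1ℚ + i))
    ≡ (1ℚ + (1ℚ + i)) * (F * (x - i))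
  simplify = solve-∀ ℚ-ring

centre : ℕ → ℚ
centre k = (ℕ→ℚ k - 1ℚ) * ½

centred : ℕ → ℕ → ℚ
centred k q = ℕ→ℚ q - centre k

centred-suc : ∀ k q → centred (suc k) q ≡ centred k q - ½
centred-suc k q = trans (cong (λ κ → ℕ→ℚ q - (κ - 1ℚ) * ½) (ℕ→ℚ-suc k)) (shift (ℕ→ℚ q) (ℕ→ℚ k))
  where
  shift : ∀ x κ → x - ((1ℚ + κ) - 1ℚ) * ½ ≡ x - (κ - 1ℚ) * ½ - ½
  shift = solve-∀ ℚ-ring

centred-+ : ∀ k d q → centred k (d ℕ.+ q) ≡ ℕ→ℚ d + centred k q
centred-+ k d q = trans (cong (_- centre k) (ℕ→ℚ-+ d q)) (ℚ.+-assoc (ℕ→ℚ d) (ℕ→ℚ q) (- centre k))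

-- The vⱼ of the statement for k states, up to normalisation.
v₁ v₂ v₃ : ℕ → ℕ → ℚ
v₁ k q = centred k q
v₂ k q = centred k q * centred k q - (ℕ→ℚ k + 1ℚ) * (+ 1 / 12)
v₃ k q = centred k q * centred k q * centred k q - (ℕ→ℚ k + 1ℚ) * (+ 1 / 4) * centred k q

v₁-suc : ∀ k q → v₁ (suc k) q ≡ v₁ k q + (- ½)
v₁-suc = centred-suc

v₂-suc : ∀ k q → v₂ (suc k) q ≡ v₂ k q + (- 1ℚ) * v₁ k q + + 1 / 6
v₂-suc k q = trans (cong₂ (λ z κ → z * z - (κ + 1ℚ) * (+ 1 / 12)) (centred-suc k q) (ℕ→ℚ-suc k))
                   (expand (centred k q) (ℕ→ℚ k))
  where
  expand : ∀ z κ → (z - ½) * (z - ½) - ((1ℚ + κ) + 1ℚ) * (+ 1 / 12)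
                   ≡ z * z - (κ + 1ℚ) * (+ 1 / 12) + (- 1ℚ) * z + + 1 / 6
  expand = solve-∀ ℚ-ring

v₃-suc : ∀ k q → v₃ (suc k) q ≡ v₃ k q + (- (+ 3 / 2)) * v₂ k q + ½ * v₁ k q
v₃-suc k q = trans (cong₂ (λ z κ → z * z * z - (κ + 1ℚ) * (+ 1 / 4) * z) (centred-suc k q) (ℕ→ℚ-suc k))
                   (expand (centred k q) (ℕ→ℚ k))
  where
  expand : ∀ z κ → (z - ½) * (z - ½) * (z - ½) - ((1ℚ + κ) + 1ℚ) * (+ 1 / 4) * (z - ½)
                   ≡ z * z * z - (κ + 1ℚ) * (+ 1 / 4) * z
                     + (- (+ 3 / 2)) * (z * z - (κ + 1ℚ) * (+ 1 / 12)) + ½ * z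
  expand = solve-∀ ℚ-ring

v₁-fallingFactorial : ∀ q → v₁ 1 q ≡ fallingFactorial 1 q
v₁-fallingFactorial q = expand (ℕ→ℚ q)
  where
  expand : ∀ x → x - (ℕ→ℚ 1 - 1ℚ) * ½ ≡ 1ℚ * (x - ℕ→ℚ 0)
  expand = solve-∀ ℚ-ring

v₂-fallingFactorial : ∀ q → v₂ 2 q ≡ fallingFactorial 2 q
v₂-fallingFactorial q = expand (ℕ→ℚ q)
  where
  expand : ∀ x → (x - (ℕ→ℚ 2 - 1ℚ) * ½) * (x - (ℕ→ℚ 2 - 1ℚ) * ½) - (ℕ→ℚ 2 + 1ℚ) * (+ 1 / 12)
                 ≡ 1ℚ * (x - ℕ→ℚ 0) * (x - ℕ→ℚ 1)
  expand = solve-∀ ℚ-ring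

v₃-fallingFactorial : ∀ q → v₃ 3 q ≡ fallingFactorial 3 q
v₃-fallingFactorial q = expand (ℕ→ℚ q)
  where
  expand : ∀ x → (x - (ℕ→ℚ 3 - 1ℚ) * ½) * (x - (ℕ→ℚ 3 - 1ℚ) * ½) * (x - (ℕ→ℚ 3 - 1ℚ) * ½)
                 - (ℕ→ℚ 3 + 1ℚ) * (+ 1 / 4) * (x - (ℕ→ℚ 3 - 1ℚ) * ½)
                 ≡ 1ℚ * (x - ℕ→ℚ 0) * (x - ℕ→ℚ 1) * (x - ℕ→ℚ 2)
  expand = solve-∀ ℚ-ring

v₂-cubic : ∀ k i → let h = centre k in
           v₂ k i ≡ cubic (h * h - (ℕ→ℚ k + 1ℚ) * (+ 1 / 12)) (- (ℕ→ℚ 2 * h)) 1ℚ 0ℚ (ℕ→ℚ i)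
v₂-cubic k i = expand (ℕ→ℚ i) (centre k) ((ℕ→ℚ k + 1ℚ) * (+ 1 / 12))
  where
  expand : ∀ x h c → (x - h) * (x - h) - c ≡ h * h - c + (- (ℕ→ℚ 2 * h)) * x + 1ℚ * (x * x) + 0ℚ * (x * x * x)
  expand = solve-∀ ℚ-ring

v₃-cubic : ∀ k i → let h = centre k ; c = (ℕ→ℚ k + 1ℚ) * (+ 1 / 4) in
           v₃ k i ≡ cubic (c * h - h * h * h) (ℕ→ℚ 3 * (h * h) - c) (- (ℕ→ℚ 3 * h)) 1ℚ (ℕ→ℚ i)
v₃-cubic k i = expand (ℕ→ℚ i) (centre k) ((ℕ→ℚ k + 1ℚ) * (+ 1 / 4))
  where
  expand : ∀ x h c → (x - h) * (x - h) * (x - h) - c * (x - h)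
                     ≡ c * h - h * h * h + (ℕ→ℚ 3 * (h * h) - c) * x + (- (ℕ→ℚ 3 * h)) * (x * x) + 1ℚ * (x * x * x)
  expand = solve-∀ ℚ-ring

Δ²v₂≡2 : ∀ k → Δⁿ 2 (v₂ k) 0 ≡ ℕ→ℚ 2
Δ²v₂≡2 k = expand (centre k) ((ℕ→ℚ k + 1ℚ) * (+ 1 / 12))
  where
  expand : ∀ h c → let f x = (x - h) * (x - h) - c in
                   (f (ℕ→ℚ 2) - f (ℕ→ℚ 1)) - (f (ℕ→ℚ 1) - f (ℕ→ℚ 0)) ≡ ℕ→ℚ 2
  expand = solve-∀ ℚ-ring

Δ³v₃≡6 : ∀ k → Δⁿ 3 (v₃ k) 0 ≡ ℕ→ℚ 6
Δ³v₃≡6 k = expand (centre k) ((ℕ→ℚ k + 1ℚ) * (+ 1 / 4))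
  where
  expand : ∀ h c → let f x = (x - h) * (x - h) * (x - h) - c * (x - h) in
                   ((f (ℕ→ℚ 3) - f (ℕ→ℚ 2)) - (f (ℕ→ℚ 2) - f (ℕ→ℚ 1)))
                   - ((f (ℕ→ℚ 2) - f (ℕ→ℚ 1)) - (f (ℕ→ℚ 1) - f (ℕ→ℚ 0))) ≡ ℕ→ℚ 6
  expand = solve-∀ ℚ-ring

binomialSum : ℚ → ℕ → (ℕ → ℚ) → ℚ
binomialSum x m f = ∑[ i < suc m ] (ℕ→ℚ (m C i) * f i * x ^ℚ i)

binomialSum-cong : ∀ x m {f g : ℕ → ℚ} → (∀ i → f i ≡ g i) → binomialSum x m f ≡ binomialSum x m g
binomialSum-cong x m f≗g = ∑-cong (suc m) (λ i _ → cong (λ y → ℕ→ℚ (m C i) * y * x ^ℚ i) (f≗g i))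

binomialSum-scale : ∀ x m a f → binomialSum x m (λ i → a * f i) ≡ a * binomialSum x m f
binomialSum-scale x m a f =
  trans (∑-cong (suc m) (λ i _ → swap (ℕ→ℚ (m C i)) a (f i) (x ^ℚ i))) (∑-scale (suc m) a (λ i → ℕ→ℚ (m C i) * f i * x ^ℚ i))
  where
  swap : ∀ c a y z → c * (a * y) * z ≡ a * (c * y * z)
  swap = solve-∀ ℚ-ring

binomialSum-suc : ∀ x m f → binomialSum x (suc m) f ≡ binomialSum x m f + x * binomialSum x m (λ i → f (suc i))
binomialSum-suc x m f = begin
  ℕ→ℚ (suc m C 0) * f 0 * 1ℚ + ∑[ i < suc m ] (ℕ→ℚ (suc m C suc i) * f (suc i) * x ^ℚ suc i)
    ≡⟨ cong (_+_ (ℕ→ℚ (suc m C 0) * f 0 * 1ℚ)) (∑-cong (suc m) (λ i _ → pascal i)) ⟩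
  ℕ→ℚ 1 * f 0 * 1ℚ + ∑[ i < suc m ] (G (suc i) + x * (ℕ→ℚ (m C i) * f (suc i) * x ^ℚ i))
    ≡⟨ cong (_+_ (ℕ→ℚ 1 * f 0 * 1ℚ)) (trans (∑-+ (suc m) (λ i → G (suc i)) (λ i → x * F i)) (cong (_+_ (∑[ i < suc m ] G (suc i))) (∑-scale (suc m) x F))) ⟩
  ℕ→ℚ 1 * f 0 * 1ℚ + (∑[ i < suc m ] G (suc i) + x * binomialSum x m (λ i → f (suc i)))
    ≡⟨ ℚ.+-assoc (G 0) (∑[ i < suc m ] G (suc i)) (x * binomialSum x m (λ i → f (suc i))) ⟨
  ∑ (suc (suc m)) G + x * binomialSum x m (λ i → f (suc i))
    ≡⟨ cong (_+ x * binomialSum x m (λ i → f (suc i))) (trans (∑-snoc (suc m) G) (trans (cong (_+_ (binomialSum x m f)) G-top) (ℚ.+-identityʳ (binomialSum x m f)))) ⟩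
  binomialSum x m f + x * binomialSum x m (λ i → f (suc i)) ∎
  where
  open ≡-Reasoning
  G F : ℕ → ℚ
  G i = ℕ→ℚ (m C i) * f i * x ^ℚ i
  F i = ℕ→ℚ (m C i) * f (suc i) * x ^ℚ i
  pascal : ∀ i → ℕ→ℚ (suc m C suc i) * f (suc i) * x ^ℚ suc i ≡ G (suc i) + x * (ℕ→ℚ (m C i) * f (suc i) * x ^ℚ i)
  pascal i = begin
    ℕ→ℚ (suc m C suc i) * f (suc i) * x ^ℚ suc i
      ≡⟨ cong (λ n → ℕ→ℚ n * f (suc i) * x ^ℚ suc i) (nCk+nC[k+1]≡[n+1]C[k+1] m i) ⟨
    ℕ→ℚ (m C i ℕ.+ m C suc i) * f (suc i) * x ^ℚ suc i
      ≡⟨ cong (λ y → y * f (suc i) * x ^ℚ suc i) (ℕ→ℚ-+ (m C i) (m C suc i)) ⟩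
    (ℕ→ℚ (m C i) + ℕ→ℚ (m C suc i)) * f (suc i) * (x * x ^ℚ i)
      ≡⟨ distrib (ℕ→ℚ (m C i)) (ℕ→ℚ (m C suc i)) (f (suc i)) x (x ^ℚ i) ⟩
    G (suc i) + x * (ℕ→ℚ (m C i) * f (suc i) * x ^ℚ i) ∎
    where
    distrib : ∀ a b y x X → (a + b) * y * (x * X) ≡ b * y * (x * X) + x * (a * y * X)
    distrib = solve-∀ ℚ-ring
  G-top : G (suc m) ≡ 0ℚ
  G-top = trans (cong (λ n → ℕ→ℚ n * f (suc m) * x ^ℚ suc m) (k>n⇒nCk≡0 (ℕ.n<1+n m)))
                (trans (cong (_* x ^ℚ suc m) (ℚ.*-zeroˡ (f (suc m)))) (ℚ.*-zeroˡ (x ^ℚ suc m)))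

-- Σᵢ C(m,i) i(i-1)⋯(i-r+1) xⁱ = m(m-1)⋯(m-r+1) xʳ (1 + x)^(m-r), collected for r ≤ 3.
binomialCubic : ℚ → ℚ → ℚ → ℚ → ℚ → ℚ → ℚ
binomialCubic M a b c e x =
  a * ((1ℚ + x) * (1ℚ + x) * (1ℚ + x)) + (b + c + e) * M * x * ((1ℚ + x) * (1ℚ + x))
  + (c + ℕ→ℚ 3 * e) * (M * (M - 1ℚ)) * (x * x) * (1ℚ + x) + e * (M * (M - 1ℚ) * (M - ℕ→ℚ 2)) * (x * x * x)

binomialSum-cubic : ∀ x t a b c e →
  binomialSum x (3 ℕ.+ t) (λ i → cubic a b c e (ℕ→ℚ i)) ≡ (1ℚ + x) ^ℚ t * binomialCubic (ℕ→ℚ (3 ℕ.+ t)) a b c e x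
binomialSum-cubic x zero    a b c e = expand a b c e x
  where
  expand : ∀ a b c e x →
    let p i = a + b * i + c * (i * i) + e * (i * i * i)
        Φ M a b c e = a * ((1ℚ + x) * (1ℚ + x) * (1ℚ + x)) + (b + c + e) * M * x * ((1ℚ + x) * (1ℚ + x))
                 + (c + ℕ→ℚ 3 * e) * (M * (M - 1ℚ)) * (x * x) * (1ℚ + x)
                 + e * (M * (M - 1ℚ) * (M - ℕ→ℚ 2)) * (x * x * x)
    in ℕ→ℚ 1 * p (ℕ→ℚ 0) * 1ℚ + (ℕ→ℚ 3 * p (ℕ→ℚ 1) * (x * 1ℚ) + (ℕ→ℚ 3 * p (ℕ→ℚ 2) * (x * (x * 1ℚ))
       + (ℕ→ℚ 1 * p (ℕ→ℚ 3) * (x * (x * (x * 1ℚ))) + 0ℚ)))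
       ≡ 1ℚ * Φ (ℕ→ℚ 3) a b c e
  expand = solve-∀ ℚ-ring
binomialSum-cubic x (suc t) a b c e = begin
  binomialSum x (suc m) f
    ≡⟨ binomialSum-suc x m f ⟩
  binomialSum x m f + x * binomialSum x m (λ i → f (suc i))
    ≡⟨ cong (λ y → binomialSum x m f + x * y) (binomialSum-cong x m (λ i → shift (ℕ→ℚ (suc i)) (ℕ→ℚ i) (ℕ→ℚ-suc i))) ⟩
  binomialSum x m f + x * binomialSum x m (λ i → cubic (a + b + c + e) (b + ℕ→ℚ 2 * c + ℕ→ℚ 3 * e) (c + ℕ→ℚ 3 * e) e (ℕ→ℚ i))
    ≡⟨ cong₂ (λ y z → y + x * z) (binomialSum-cubic x t a b c e)
             (binomialSum-cubic x t (a + b + c + e) (b + ℕ→ℚ 2 * c + ℕ→ℚ 3 * e) (c + ℕ→ℚ 3 * e) e) ⟩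
  (1ℚ + x) ^ℚ t * binomialCubic (ℕ→ℚ m) a b c e x
  + x * ((1ℚ + x) ^ℚ t * binomialCubic (ℕ→ℚ m) (a + b + c + e) (b + ℕ→ℚ 2 * c + ℕ→ℚ 3 * e) (c + ℕ→ℚ 3 * e) e x)
    ≡⟨ step a b c e x (ℕ→ℚ m) ((1ℚ + x) ^ℚ t) ⟩
  (1ℚ + x) ^ℚ suc t * binomialCubic (1ℚ + ℕ→ℚ m) a b c e x
    ≡⟨ cong (λ M → (1ℚ + x) ^ℚ suc t * binomialCubic M a b c e x) (ℕ→ℚ-suc m) ⟨
  (1ℚ + x) ^ℚ suc t * binomialCubic (ℕ→ℚ (suc m)) a b c e x ∎
  where
  open ≡-Reasoning
  m : ℕ
  m = 3 ℕ.+ t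
  f : ℕ → ℚ
  f i = cubic a b c e (ℕ→ℚ i)
  shift : ∀ y i → y ≡ 1ℚ + i →
          cubic a b c e y ≡ cubic (a + b + c + e) (b + ℕ→ℚ 2 * c + ℕ→ℚ 3 * e) (c + ℕ→ℚ 3 * e) e i
  shift _ i refl = expand a b c e i
    where
    expand : ∀ a b c e i → let p a b c e z = a + b * z + c * (z * z) + e * (z * z * z) in
             p a b c e (1ℚ + i) ≡ p (a + b + c + e) (b + ℕ→ℚ 2 * c + ℕ→ℚ 3 * e) (c + ℕ→ℚ 3 * e) e i
    expand = solve-∀ ℚ-ring
  step : ∀ a b c e x M Y →
    let Φ M a b c e = a * ((1ℚ + x) * (1ℚ + x) * (1ℚ + x)) + (b + c + e) * M * x * ((1ℚ + x) * (1ℚ + x))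
                 + (c + ℕ→ℚ 3 * e) * (M * (M - 1ℚ)) * (x * x) * (1ℚ + x)
                 + e * (M * (M - 1ℚ) * (M - ℕ→ℚ 2)) * (x * x * x)
    in Y * Φ M a b c e + x * (Y * Φ M (a + b + c + e) (b + ℕ→ℚ 2 * c + ℕ→ℚ 3 * e) (c + ℕ→ℚ 3 * e) e)
       ≡ (1ℚ + x) * Y * Φ (1ℚ + M) a b c e
  step = solve-∀ ℚ-ring

ℕ→ℚ[3*[1+m]∸1] : ∀ m → ℕ→ℚ (3 ℕ.* suc m ∸ 1) ≡ ℕ→ℚ 2 + ℕ→ℚ 3 * ℕ→ℚ m
ℕ→ℚ[3*[1+m]∸1] m = trans (cong (λ n → ℕ→ℚ (n ∸ 1)) (3*[1+m]≡3+3*m m)) (ℕ→ℚ-affine 2 3 m)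

ℕ→ℚ[3*[1+m]] : ∀ m → ℕ→ℚ (3 ℕ.* suc m) ≡ ℕ→ℚ 3 + ℕ→ℚ 3 * ℕ→ℚ m
ℕ→ℚ[3*[1+m]] m = trans (cong ℕ→ℚ (3*[1+m]≡3+3*m m)) (ℕ→ℚ-affine 3 3 m)

-- v₂ k 0 = (3k - 1)(k - 2)/12 cancels the factor 1/(3k - 1) of Q₂.
binomialSum-v₂ : ∀ t x → binomialSum x (3 ℕ.+ t) (v₂ (4 ℕ.+ t)) ≡ v₂ (4 ℕ.+ t) 0 * ((1ℚ + x) ^ℚ suc t * Q2 (4 ℕ.+ t) x)
binomialSum-v₂ t x = begin
  binomialSum x m (v₂ k)                             ≡⟨ binomialSum-cong x m (v₂-cubic k) ⟩
  binomialSum x m (λ i → cubic a b 1ℚ 0ℚ (ℕ→ℚ i))    ≡⟨ binomialSum-cubic x t a b 1ℚ 0ℚ ⟩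
  (1ℚ + x) ^ℚ t * binomialCubic (ℕ→ℚ m) a b 1ℚ 0ℚ x
    ≡⟨ factorise (ℕ→ℚ m) (ℕ→ℚ-suc m) (ℕ→ℚ[3*[1+m]∸1] m) (ℕ→ℚ[3*[1+m]] m) (1/n*n≡1 (suc (3 ℕ.* k ∸ 2))) ⟩
  v₂ k 0 * ((1ℚ + x) ^ℚ suc t * Q2 k x)               ∎
  where
  open ≡-Reasoning
  m k : ℕ
  m = 3 ℕ.+ t
  k = suc m
  ι h a b : ℚ
  ι = + 1 / suc (3 ℕ.* k ∸ 2)
  h = centre k
  a = h * h - (ℕ→ℚ k + 1ℚ) * (+ 1 / 12)
  b = - (ℕ→ℚ 2 * h)
  factorise : ∀ {κ P₁ P₂} M → κ ≡ 1ℚ + M → P₁ ≡ ℕ→ℚ 2 + ℕ→ℚ 3 * M → P₂ ≡ ℕ→ℚ 3 + ℕ→ℚ 3 * M → ι * P₁ ≡ 1ℚ →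
              let h = (κ - 1ℚ) * ½ in
              (1ℚ + x) ^ℚ t * binomialCubic M (h * h - (κ + 1ℚ) * (+ 1 / 12)) (- (ℕ→ℚ 2 * h)) 1ℚ 0ℚ x
              ≡ ((ℕ→ℚ 0 - h) * (ℕ→ℚ 0 - h) - (κ + 1ℚ) * (+ 1 / 12))
                * ((1ℚ + x) * (1ℚ + x) ^ℚ t * ((P₁ * (1ℚ + x * x) - ℕ→ℚ 2 * (P₂ - ℕ→ℚ 5) * x) * ι))
  factorise M refl refl refl ιP₁≡1 = *-unitʳ (ι * (ℕ→ℚ 2 + ℕ→ℚ 3 * M)) ιP₁≡1 (expand M ι x ((1ℚ + x) ^ℚ t))
    where
    expand : ∀ M ι x Y →
      let κ = 1ℚ + M
          h = (κ - 1ℚ) * ½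
          Φ M a b c e = a * ((1ℚ + x) * (1ℚ + x) * (1ℚ + x)) + (b + c + e) * M * x * ((1ℚ + x) * (1ℚ + x))
                       + (c + ℕ→ℚ 3 * e) * (M * (M - 1ℚ)) * (x * x) * (1ℚ + x)
                       + e * (M * (M - 1ℚ) * (M - ℕ→ℚ 2)) * (x * x * x)
      in Y * Φ M (h * h - (κ + 1ℚ) * (+ 1 / 12)) (- (ℕ→ℚ 2 * h)) 1ℚ 0ℚ * (ι * (ℕ→ℚ 2 + ℕ→ℚ 3 * M))
         ≡ ((ℕ→ℚ 0 - h) * (ℕ→ℚ 0 - h) - (κ + 1ℚ) * (+ 1 / 12))
           * ((1ℚ + x) * Y * (((ℕ→ℚ 2 + ℕ→ℚ 3 * M) * (1ℚ + x * x) - ℕ→ℚ 2 * ((ℕ→ℚ 3 + ℕ→ℚ 3 * M) - ℕ→ℚ 5) * x) * ι))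
    expand = solve-∀ ℚ-ring

-- v₃ k 0 = -(k - 1) k (k - 3)/8 cancels the factor 1/k of Q₃.
binomialSum-v₃ : ∀ t x → binomialSum x (4 ℕ.+ t) (v₃ (5 ℕ.+ t)) ≡ v₃ (5 ℕ.+ t) 0 * ((1ℚ + x) ^ℚ suc t * Q3 (5 ℕ.+ t) x)
binomialSum-v₃ t x = begin
  binomialSum x m (v₃ k)                             ≡⟨ binomialSum-cong x m (v₃-cubic k) ⟩
  binomialSum x m (λ i → cubic a b c 1ℚ (ℕ→ℚ i))     ≡⟨ binomialSum-cubic x (suc t) a b c 1ℚ ⟩
  (1ℚ + x) ^ℚ suc t * binomialCubic (ℕ→ℚ m) a b c 1ℚ x
    ≡⟨ factorise (ℕ→ℚ m) (ℕ→ℚ-suc m) (1/n*n≡1 k) ⟩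
  v₃ k 0 * ((1ℚ + x) ^ℚ suc t * Q3 k x)               ∎
  where
  open ≡-Reasoning
  m k : ℕ
  m = 4 ℕ.+ t
  k = suc m
  ι h a b c : ℚ
  ι = + 1 / k
  h = centre k
  a = (ℕ→ℚ k + 1ℚ) * (+ 1 / 4) * h - h * h * h
  b = ℕ→ℚ 3 * (h * h) - (ℕ→ℚ k + 1ℚ) * (+ 1 / 4)
  c = - (ℕ→ℚ 3 * h)
  factorise : ∀ {κ} M → κ ≡ 1ℚ + M → ι * κ ≡ 1ℚ →
              let h = (κ - 1ℚ) * ½ ; c = (κ + 1ℚ) * (+ 1 / 4) in
              (1ℚ + x) ^ℚ suc t * binomialCubic M (c * h - h * h * h) (ℕ→ℚ 3 * (h * h) - c) (- (ℕ→ℚ 3 * h)) 1ℚ x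
              ≡ ((ℕ→ℚ 0 - h) * (ℕ→ℚ 0 - h) * (ℕ→ℚ 0 - h) - c * (ℕ→ℚ 0 - h))
                * ((1ℚ + x) ^ℚ suc t * ((- ((x - 1ℚ) * (κ * (x * x) - ℕ→ℚ 2 * (κ - ℕ→ℚ 4) * x + κ))) * ι))
  factorise M refl ικ≡1 = *-unitʳ (ι * (1ℚ + M)) ικ≡1 (expand M ι x ((1ℚ + x) ^ℚ suc t))
    where
    expand : ∀ M ι x Y →
      let κ = 1ℚ + M
          h = (κ - 1ℚ) * ½
          c = (κ + 1ℚ) * (+ 1 / 4)
          Φ M a b c e = a * ((1ℚ + x) * (1ℚ + x) * (1ℚ + x)) + (b + c + e) * M * x * ((1ℚ + x) * (1ℚ + x))
                       + (c + ℕ→ℚ 3 * e) * (M * (M - 1ℚ)) * (x * x) * (1ℚ + x)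
                       + e * (M * (M - 1ℚ) * (M - ℕ→ℚ 2)) * (x * x * x)
      in Y * Φ M (c * h - h * h * h) (ℕ→ℚ 3 * (h * h) - c) (- (ℕ→ℚ 3 * h)) 1ℚ * (ι * (1ℚ + M))
         ≡ ((ℕ→ℚ 0 - h) * (ℕ→ℚ 0 - h) * (ℕ→ℚ 0 - h) - c * (ℕ→ℚ 0 - h))
           * (Y * ((- ((x - 1ℚ) * (κ * (x * x) - ℕ→ℚ 2 * (κ - ℕ→ℚ 4) * x + κ))) * ι))
    expand = solve-∀ ℚ-ring

v₂-0-inverse : ∀ t → v₂ (4 ℕ.+ t) 0 * (ℕ→ℚ 12 * (+ 1 / suc (3 ℕ.* (4 ℕ.+ t) ∸ 2)) * (+ 1 / (2 ℕ.+ t))) ≡ 1ℚ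
v₂-0-inverse t =
  invert (ℕ→ℚ (2 ℕ.+ t)) (+ 1 / suc (3 ℕ.* (4 ℕ.+ t) ∸ 2)) (+ 1 / (2 ℕ.+ t))
         (ℕ→ℚ-suc (3 ℕ.+ t)) (ℕ→ℚ-suc (2 ℕ.+ t)) (ℕ→ℚ[3*[1+m]∸1] (3 ℕ.+ t))
         (1/n*n≡1 (suc (3 ℕ.* (4 ℕ.+ t) ∸ 2))) (1/n*n≡1 (2 ℕ.+ t))
  where
  invert : ∀ {κ M P₁} ℓ ι λ′ → κ ≡ 1ℚ + M → M ≡ 1ℚ + ℓ → P₁ ≡ ℕ→ℚ 2 + ℕ→ℚ 3 * M → ι * P₁ ≡ 1ℚ → λ′ * ℓ ≡ 1ℚ →
           let h = (κ - 1ℚ) * ½ in ((ℕ→ℚ 0 - h) * (ℕ→ℚ 0 - h) - (κ + 1ℚ) * (+ 1 / 12)) * (ℕ→ℚ 12 * ι * λ′) ≡ 1ℚ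
  invert ℓ ι λ′ refl refl refl ιP₁≡1 λ′ℓ≡1 =
    trans (expand ℓ ι λ′) (trans (cong₂ _*_ ιP₁≡1 λ′ℓ≡1) (ℚ.*-identityˡ 1ℚ))
    where
    expand : ∀ ℓ ι λ′ → let κ = 1ℚ + (1ℚ + ℓ) ; h = (κ - 1ℚ) * ½ in
             ((ℕ→ℚ 0 - h) * (ℕ→ℚ 0 - h) - (κ + 1ℚ) * (+ 1 / 12)) * (ℕ→ℚ 12 * ι * λ′)
             ≡ ι * (ℕ→ℚ 2 + ℕ→ℚ 3 * (1ℚ + ℓ)) * (λ′ * ℓ)
    expand = solve-∀ ℚ-ring

v₃-0-inverse : ∀ t → v₃ (5 ℕ.+ t) 0 * (- (ℕ→ℚ 8 * (+ 1 / (4 ℕ.+ t)) * (+ 1 / (5 ℕ.+ t)) * (+ 1 / (2 ℕ.+ t)))) ≡ 1ℚ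
v₃-0-inverse t =
  invert (ℕ→ℚ (2 ℕ.+ t)) (+ 1 / (4 ℕ.+ t)) (+ 1 / (5 ℕ.+ t)) (+ 1 / (2 ℕ.+ t))
         (ℕ→ℚ-suc (4 ℕ.+ t)) (ℕ→ℚ-+ 2 (2 ℕ.+ t))
         (1/n*n≡1 (4 ℕ.+ t)) (1/n*n≡1 (5 ℕ.+ t)) (1/n*n≡1 (2 ℕ.+ t))
  where
  invert : ∀ {κ M} ℓ α ι λ′ → κ ≡ 1ℚ + M → M ≡ ℕ→ℚ 2 + ℓ → α * M ≡ 1ℚ → ι * κ ≡ 1ℚ → λ′ * ℓ ≡ 1ℚ →
           let h = (κ - 1ℚ) * ½ in
           ((ℕ→ℚ 0 - h) * (ℕ→ℚ 0 - h) * (ℕ→ℚ 0 - h) - (κ + 1ℚ) * (+ 1 / 4) * (ℕ→ℚ 0 - h)) * (- (ℕ→ℚ 8 * α * ι * λ′)) ≡ 1ℚ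
  invert ℓ α ι λ′ refl refl αM≡1 ικ≡1 λ′ℓ≡1 =
    trans (expand ℓ α ι λ′) (trans (cong₂ _*_ (cong₂ _*_ αM≡1 ικ≡1) λ′ℓ≡1) (ℚ.*-identityˡ 1ℚ))
    where
    expand : ∀ ℓ α ι λ′ → let κ = 1ℚ + (ℕ→ℚ 2 + ℓ) ; h = (κ - 1ℚ) * ½ in
             ((ℕ→ℚ 0 - h) * (ℕ→ℚ 0 - h) * (ℕ→ℚ 0 - h) - (κ + 1ℚ) * (+ 1 / 4) * (ℕ→ℚ 0 - h)) * (- (ℕ→ℚ 8 * α * ι * λ′))
             ≡ α * (ℕ→ℚ 2 + ℓ) * (ι * κ) * (λ′ * ℓ)
    expand = solve-∀ ℚ-ring

module CarrySum (N : ℕ) .{{_ : NonZero N}} where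

  carrySum : ℕ → (ℕ → ℚ) → ℕ → ℚ
  carrySum zero    g c = g (c div N)
  carrySum (suc k) g c = ∑[ d < N ] carrySum k g (d ℕ.+ c)

  carrySum-tuples : ∀ k g c → sumL (List.map (λ t → g ((sum t ℕ.+ c) div N)) (tuples k N)) ≡ carrySum k g c
  carrySum-tuples zero    g c = ℚ.+-identityʳ (g (c div N))
  carrySum-tuples (suc k) g c = begin
    sumL (List.map F (List.concatMap (λ d → List.map (d ∷_) (tuples k N)) (List.upTo N)))
      ≡⟨ sumL-concatMap F (λ d → List.map (d ∷_) (tuples k N)) (List.upTo N) ⟩
    sumL (List.map (λ d → sumL (List.map F (List.map (d ∷_) (tuples k N)))) (List.upTo N))
      ≡⟨ sumL-applyUpTo N (λ d → d) _ ⟩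
    ∑[ d < N ] sumL (List.map F (List.map (d ∷_) (tuples k N)))
      ≡⟨ ∑-cong N (λ d _ → cong sumL (List.map-∘ (tuples k N))) ⟨
    ∑[ d < N ] sumL (List.map (λ t → F (d ∷ t)) (tuples k N))
      ≡⟨ ∑-cong N (λ d _ → trans (cong sumL (List.map-cong (λ t → cong (λ x → g (x div N)) (reassoc d (sum t) c)) (tuples k N)))
                                  (carrySum-tuples k g (d ℕ.+ c))) ⟩
    ∑[ d < N ] carrySum k g (d ℕ.+ c) ∎
    where
    open ≡-Reasoning
    F : List ℕ → ℚ
    F t = g ((sum t ℕ.+ c) div N)
    reassoc : ∀ d s c → d ℕ.+ s ℕ.+ c ≡ s ℕ.+ (d ℕ.+ c)
    reassoc = ℕ-Solver.solve-∀

  P-carrySum : ∀ k (v : Fin k → ℚ) c → Σℚ k (λ c′ → P N k c c′ * v c′) ≡ invPow N k * carrySum k (extend k v) (toℕ c)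
  P-carrySum k v c = begin
    Σℚ k (λ c′ → ℕ→ℚ (carryCount N k (toℕ c) (toℕ c′)) * invPow N k * v c′)
      ≡⟨ Σℚ-cong k (λ c′ → swap (ℕ→ℚ (carryCount N k (toℕ c) (toℕ c′))) (invPow N k) (v c′)) ⟩
    Σℚ k (λ c′ → invPow N k * (ℕ→ℚ (carryCount N k (toℕ c) (toℕ c′)) * v c′))
      ≡⟨ Σℚ-scale k (invPow N k) _ ⟩
    invPow N k * Σℚ k (λ c′ → ℕ→ℚ (carryCount N k (toℕ c) (toℕ c′)) * v c′)
      ≡⟨ cong (invPow N k *_) (trans (Σℚ-count k v (λ t → (sum t ℕ.+ toℕ c) div N) (tuples k N))
                                     (carrySum-tuples k (extend k v) (toℕ c))) ⟩
    invPow N k * carrySum k (extend k v) (toℕ c) ∎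
    where
    open ≡-Reasoning
    swap : ∀ a b w → a * b * w ≡ b * (a * w)
    swap = solve-∀ ℚ-ring

  carrySum-cong : ∀ k {f g : ℕ → ℚ} → (∀ q → f q ≡ g q) → ∀ c → carrySum k f c ≡ carrySum k g c
  carrySum-cong zero    f≡g c = f≡g (c div N)
  carrySum-cong (suc k) f≡g c = ∑-cong N (λ d _ → carrySum-cong k f≡g (d ℕ.+ c))

  carrySum-+ : ∀ k (f g : ℕ → ℚ) c → carrySum k (λ q → f q + g q) c ≡ carrySum k f c + carrySum k g c
  carrySum-+ zero    f g c = refl
  carrySum-+ (suc k) f g c =
    trans (∑-cong N (λ d _ → carrySum-+ k f g (d ℕ.+ c)))
          (∑-+ N (λ d → carrySum k f (d ℕ.+ c)) (λ d → carrySum k g (d ℕ.+ c)))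

  carrySum-scale : ∀ k a (f : ℕ → ℚ) c → carrySum k (λ q → a * f q) c ≡ a * carrySum k f c
  carrySum-scale zero    a f c = refl
  carrySum-scale (suc k) a f c =
    trans (∑-cong N (λ d _ → carrySum-scale k a f (d ℕ.+ c))) (∑-scale N a (λ d → carrySum k f (d ℕ.+ c)))

  carrySum-lin : ∀ k a (f g : ℕ → ℚ) c →
                 carrySum k (λ q → f q + a * g q) c ≡ carrySum k f c + a * carrySum k g c
  carrySum-lin k a f g c =
    trans (carrySum-+ k f (λ q → a * g q) c) (cong (_+_ (carrySum k f c)) (carrySum-scale k a g c))

  carrySum-const : ∀ k a c → carrySum k (λ _ → a) c ≡ ℕ→ℚ N ^ℚ k * a
  carrySum-const zero    a c = sym (ℚ.*-identityˡ a)
  carrySum-const (suc k) a c = begin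
    ∑[ d < N ] carrySum k (λ _ → a) (d ℕ.+ c)   ≡⟨ ∑-cong N (λ d _ → carrySum-const k a (d ℕ.+ c)) ⟩
    ∑[ d < N ] (ℕ→ℚ N ^ℚ k * a)               ≡⟨ ∑-const N (ℕ→ℚ N ^ℚ k * a) ⟩
    ℕ→ℚ N * (ℕ→ℚ N ^ℚ k * a)                  ≡⟨ ℚ.*-assoc (ℕ→ℚ N) (ℕ→ℚ N ^ℚ k) a ⟨
    ℕ→ℚ N ^ℚ suc k * a                        ∎
    where open ≡-Reasoning

  carrySum-+-const : ∀ k a (f : ℕ → ℚ) c → carrySum k (λ q → f q + a) c ≡ carrySum k f c + ℕ→ℚ N ^ℚ k * a
  carrySum-+-const k a f c = begin
    carrySum k (λ q → f q + a) c                      ≡⟨ carrySum-cong k (λ q → cong (_+_ (f q)) (ℚ.*-identityʳ a)) c ⟨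
    carrySum k (λ q → f q + a * 1ℚ) c                 ≡⟨ carrySum-lin k a f (λ _ → 1ℚ) c ⟩
    carrySum k f c + a * carrySum k (λ _ → 1ℚ) c      ≡⟨ cong (λ x → carrySum k f c + a * x) (carrySum-const k 1ℚ c) ⟩
    carrySum k f c + a * (ℕ→ℚ N ^ℚ k * 1ℚ)            ≡⟨ cong (_+_ (carrySum k f c)) (swap a (ℕ→ℚ N ^ℚ k)) ⟩
    carrySum k f c + ℕ→ℚ N ^ℚ k * a                   ∎
    where
    open ≡-Reasoning
    swap : ∀ a x → a * (x * 1ℚ) ≡ x * a
    swap = solve-∀ ℚ-ring

  carrySum-sub : ∀ k (f g : ℕ → ℚ) c → carrySum k (λ q → f q - g q) c ≡ carrySum k f c - carrySum k g c
  carrySum-sub k f g c = begin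
    carrySum k (λ q → f q - g q) c               ≡⟨ carrySum-cong k (λ q → sub-as-lin (f q) (g q)) c ⟩
    carrySum k (λ q → f q + (- 1ℚ) * g q) c      ≡⟨ carrySum-lin k (- 1ℚ) f g c ⟩
    carrySum k f c + (- 1ℚ) * carrySum k g c     ≡⟨ sub-as-lin (carrySum k f c) (carrySum k g c) ⟨
    carrySum k f c - carrySum k g c              ∎
    where
    open ≡-Reasoning
    sub-as-lin : ∀ x y → x - y ≡ x + (- 1ℚ) * y
    sub-as-lin = solve-∀ ℚ-ring

  private
    N+c/N≡1+c/N : ∀ c → (N ℕ.+ c) div N ≡ suc (c div N)
    N+c/N≡1+c/N c = trans (m/n≡1+[m∸n]/n (ℕ.m≤m+n N c)) (cong (λ x → suc (x div N)) (ℕ.m+n∸m≡n N c))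

  carrySum-shift : ∀ k g c → carrySum k g (N ℕ.+ c) ≡ carrySum k (λ q → g (suc q)) c
  carrySum-shift zero    g c = cong g (N+c/N≡1+c/N c)
  carrySum-shift (suc k) g c = ∑-cong N λ d _ →
    trans (cong (carrySum k g) (swap d N c)) (carrySum-shift k g (d ℕ.+ c))
    where
    swap : ∀ d N c → d ℕ.+ (N ℕ.+ c) ≡ N ℕ.+ (d ℕ.+ c)
    swap = ℕ-Solver.solve-∀

  Δ-carrySum : ∀ k g c → Δ (carrySum (suc k) g) c ≡ carrySum k (Δ g) c
  Δ-carrySum k g c = begin
    ∑[ d < N ] F (d ℕ.+ suc c) - ∑[ d < N ] F (d ℕ.+ c)
      ≡⟨ cong (_- ∑[ d < N ] F (d ℕ.+ c)) (∑-cong N (λ d _ → cong F (ℕ.+-suc d c))) ⟩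
    ∑[ d < N ] F (suc d ℕ.+ c) - ∑[ d < N ] F (d ℕ.+ c)
      ≡⟨ ∑-telescope N (λ d → F (d ℕ.+ c)) ⟩
    F (N ℕ.+ c) - F c
      ≡⟨ cong (_- F c) (carrySum-shift k g c) ⟩
    carrySum k (λ q → g (suc q)) c - F c
      ≡⟨ carrySum-sub k (λ q → g (suc q)) g c ⟨
    carrySum k (Δ g) c ∎
    where
    open ≡-Reasoning
    F : ℕ → ℚ
    F = carrySum k g

  Δⁿ-carrySum : ∀ r s g c → Δⁿ r (carrySum (r ℕ.+ s) g) c ≡ carrySum s (Δⁿ r g) c
  Δⁿ-carrySum zero    s g c = refl
  Δⁿ-carrySum (suc r) s g c = trans (Δⁿ-cong r (Δ-carrySum (r ℕ.+ s) g) c) (Δⁿ-carrySum r s (Δ g) c)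

  private
    -- The bound says q N ≤ k (N - 1) + c: k digits add up to at most k (N - 1).
    carrySum-local′ : ∀ k c {f g : ℕ → ℚ} → (∀ q → q ℕ.* N ℕ.+ k ≤ k ℕ.* N ℕ.+ c → f q ≡ g q) →
                      carrySum k f c ≡ carrySum k g c
    carrySum-local′ zero    c f≡g = f≡g (c div N) (ℕ.≤-trans (ℕ.≤-reflexive (ℕ.+-identityʳ _)) (m/n*n≤m c N))
    carrySum-local′ (suc k) c f≡g =
      ∑-cong N (λ d d<N → carrySum-local′ k (d ℕ.+ c) (λ q le → f≡g q (widen q d d<N le)))
      where
      widen : ∀ q d → d < N → q ℕ.* N ℕ.+ k ≤ k ℕ.* N ℕ.+ (d ℕ.+ c) → q ℕ.* N ℕ.+ suc k ≤ suc k ℕ.* N ℕ.+ c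
      widen q d d<N le = begin
        q ℕ.* N ℕ.+ suc k        ≡⟨ ℕ.+-suc (q ℕ.* N) k ⟩
        suc (q ℕ.* N ℕ.+ k)      ≤⟨ s≤s le ⟩
        suc (k ℕ.* N ℕ.+ (d ℕ.+ c))  ≡⟨ ℕ.+-suc (k ℕ.* N) (d ℕ.+ c) ⟨
        k ℕ.* N ℕ.+ (suc d ℕ.+ c)    ≤⟨ ℕ.+-monoʳ-≤ (k ℕ.* N) (ℕ.+-monoˡ-≤ c d<N) ⟩
        k ℕ.* N ℕ.+ (N ℕ.+ c)        ≡⟨ rearrange (k ℕ.* N) N c ⟩
        suc k ℕ.* N ℕ.+ c            ∎
        where
        open ℕ.≤-Reasoning
        rearrange : ∀ x N c → x ℕ.+ (N ℕ.+ c) ≡ N ℕ.+ x ℕ.+ c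
        rearrange = ℕ-Solver.solve-∀

  carrySum-local : ∀ k c {f g : ℕ → ℚ} → c < k → (∀ q → q < k → f q ≡ g q) →
                   carrySum k f c ≡ carrySum k g c
  carrySum-local k c c<k f≡g = carrySum-local′ k c λ q le → f≡g q (ℕ.≰⇒> λ k≤q →
    ℕ.<⇒≱ c<k (ℕ.+-cancelˡ-≤ (k ℕ.* N) k c (ℕ.≤-trans (ℕ.+-monoˡ-≤ k (ℕ.*-monoˡ-≤ N k≤q)) le)))

  carrySum-fallingFactorial : ∀ j c → carrySum j (fallingFactorial j) c ≡ fallingFactorial j c
  carrySum-fallingFactorial zero    c = refl
  carrySum-fallingFactorial (suc j) = Δ-injective anchor step
    where
    open ≡-Reasoning
    anchor : carrySum (suc j) (fallingFactorial (suc j)) 0 ≡ fallingFactorial (suc j) 0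
    anchor = begin
      carrySum (suc j) (fallingFactorial (suc j)) 0
        ≡⟨ carrySum-local (suc j) 0 (s≤s z≤n) (fallingFactorial-vanishes (suc j)) ⟩
      carrySum (suc j) (λ _ → 0ℚ) 0   ≡⟨ carrySum-const (suc j) 0ℚ 0 ⟩
      ℕ→ℚ N ^ℚ suc j * 0ℚ             ≡⟨ ℚ.*-zeroʳ (ℕ→ℚ N ^ℚ suc j) ⟩
      0ℚ                              ≡⟨ fallingFactorial-vanishes (suc j) 0 (s≤s z≤n) ⟨
      fallingFactorial (suc j) 0      ∎
    step : ∀ c → Δ (carrySum (suc j) (fallingFactorial (suc j))) c ≡ Δ (fallingFactorial (suc j)) c
    step c = begin
      Δ (carrySum (suc j) (fallingFactorial (suc j))) c       ≡⟨ Δ-carrySum j (fallingFactorial (suc j)) c ⟩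
      carrySum j (Δ (fallingFactorial (suc j))) c             ≡⟨ carrySum-cong j (Δ-fallingFactorial j) c ⟩
      carrySum j (λ q → ℕ→ℚ (suc j) * fallingFactorial j q) c ≡⟨ carrySum-scale j (ℕ→ℚ (suc j)) (fallingFactorial j) c ⟩
      ℕ→ℚ (suc j) * carrySum j (fallingFactorial j) c         ≡⟨ cong (ℕ→ℚ (suc j) *_) (carrySum-fallingFactorial j c) ⟩
      ℕ→ℚ (suc j) * fallingFactorial j c                      ≡⟨ Δ-fallingFactorial j c ⟨
      Δ (fallingFactorial (suc j)) c                          ∎

  carrySum-suc-cubic : ∀ k g a b c e → (∀ x → carrySum k g x ≡ cubic a b c e (centred k x)) →
                       ∀ y → carrySum (suc k) g y ≡ cubicWindowSum (ℕ→ℚ N) a b c e (centred k y)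
  carrySum-suc-cubic k g a b c e cubic-form y =
    trans (∑-cong N (λ d _ → trans (cubic-form (d ℕ.+ y)) (cong (cubic a b c e) (centred-+ k d y))))
          (∑-cubic N a b c e (centred k y))

  carrySum-≗fallingFactorial : ∀ j {v : ℕ → ℚ} → (∀ q → v q ≡ fallingFactorial j q) →
                               ∀ c → carrySum j v c ≡ 1ℚ * v c
  carrySum-≗fallingFactorial j {v} v≗ff c = begin
    carrySum j v c                    ≡⟨ carrySum-cong j v≗ff c ⟩
    carrySum j (fallingFactorial j) c ≡⟨ carrySum-fallingFactorial j c ⟩
    fallingFactorial j c              ≡⟨ v≗ff c ⟨
    v c                               ≡⟨ ℚ.*-identityˡ (v c) ⟨
    1ℚ * v c                          ∎
    where open ≡-Reasoning

  carrySum-v₁ : ∀ e c → carrySum (1 ℕ.+ e) (v₁ (1 ℕ.+ e)) c ≡ ℕ→ℚ N ^ℚ e * v₁ (1 ℕ.+ e) c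
  carrySum-v₁ zero    = carrySum-≗fallingFactorial 1 v₁-fallingFactorial
  carrySum-v₁ (suc e) c = begin
    carrySum (suc k) (v₁ (suc k)) c                 ≡⟨ carrySum-suc-cubic k (v₁ (suc k)) a₀ a₁ 0ℚ 0ℚ cubic-form c ⟩
    cubicWindowSum n a₀ a₁ 0ℚ 0ℚ (centred k c) ≡⟨ summed Nᵉ n (centred k c) ⟩
    n * Nᵉ * (v₁ k c + (- ½))    ≡⟨ cong (n * Nᵉ *_) (v₁-suc k c) ⟨
    n * Nᵉ * v₁ (suc k) c                           ∎
    where
    open ≡-Reasoning
    k : ℕ
    k = 1 ℕ.+ e
    n Nᵉ : ℚ
    n = ℕ→ℚ N
    Nᵉ = n ^ℚ e
    a₀ a₁ : ℚ
    a₀ = n * Nᵉ * (- ½)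
    a₁ = Nᵉ
    cubic-form : ∀ x → carrySum k (v₁ (suc k)) x ≡ cubic a₀ a₁ 0ℚ 0ℚ (centred k x)
    cubic-form x = begin
      carrySum k (v₁ (suc k)) x              ≡⟨ carrySum-cong k (v₁-suc k) x ⟩
      carrySum k (λ q → v₁ k q + (- ½)) x    ≡⟨ carrySum-+-const k (- ½) (v₁ k) x ⟩
      carrySum k (v₁ k) x + n * Nᵉ * (- ½)    ≡⟨ cong (_+ n * Nᵉ * (- ½)) (carrySum-v₁ e x) ⟩
      Nᵉ * centred k x + n * Nᵉ * (- ½)        ≡⟨ expand Nᵉ n (centred k x) ⟩
      cubic a₀ a₁ 0ℚ 0ℚ (centred k x) ∎
      where
      expand : ∀ Nᵉ n z →
        let a₀ = n * Nᵉ * (- ½)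
            a₁ = Nᵉ
        in Nᵉ * z + n * Nᵉ * (- ½)
           ≡ a₀ + a₁ * z + 0ℚ * (z * z) + 0ℚ * (z * z * z)
      expand = solve-∀ ℚ-ring
    summed : ∀ Nᵉ n z →
      let a₀ = n * Nᵉ * (- ½)
          a₁ = Nᵉ
          S₁ = n * (n - 1ℚ) * ½
          W a b c e = n * (a + b * z + c * (z * z) + e * (z * z * z)) + S₁ * (b + ℕ→ℚ 2 * c * z + ℕ→ℚ 3 * e * (z * z))
                      + S₁ * (ℕ→ℚ 2 * n - 1ℚ) * ⅓ * (c + ℕ→ℚ 3 * e * z) + S₁ * S₁ * e
      in W a₀ a₁ 0ℚ 0ℚ ≡ n * Nᵉ * (z + (- ½))
    summed = solve-∀ ℚ-ring

  carrySum-v₂ : ∀ e c → carrySum (2 ℕ.+ e) (v₂ (2 ℕ.+ e)) c ≡ ℕ→ℚ N ^ℚ e * v₂ (2 ℕ.+ e) c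
  carrySum-v₂ zero    = carrySum-≗fallingFactorial 2 v₂-fallingFactorial
  carrySum-v₂ (suc e) c = begin
    carrySum (suc k) (v₂ (suc k)) c                 ≡⟨ carrySum-suc-cubic k (v₂ (suc k)) a₀ a₁ a₂ 0ℚ cubic-form c ⟩
    cubicWindowSum n a₀ a₁ a₂ 0ℚ (centred k c) ≡⟨ summed Nᵉ n (centred k c) κ ⟩
    n * Nᵉ * (v₂ k c + (- 1ℚ) * v₁ k c + + 1 / 6)    ≡⟨ cong (n * Nᵉ *_) (v₂-suc k c) ⟨
    n * Nᵉ * v₂ (suc k) c                           ∎
    where
    open ≡-Reasoning
    k : ℕ
    k = 2 ℕ.+ e
    κ n Nᵉ : ℚ
    κ = ℕ→ℚ k
    n = ℕ→ℚ N
    Nᵉ = n ^ℚ e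
    a₀ a₁ a₂ : ℚ
    a₀ = n * (n * Nᵉ) * (+ 1 / 6) - Nᵉ * (κ + 1ℚ) * (+ 1 / 12)
    a₁ = - (n * Nᵉ)
    a₂ = Nᵉ
    cubic-form : ∀ x → carrySum k (v₂ (suc k)) x ≡ cubic a₀ a₁ a₂ 0ℚ (centred k x)
    cubic-form x = begin
      carrySum k (v₂ (suc k)) x
        ≡⟨ carrySum-cong k (v₂-suc k) x ⟩
      carrySum k (λ q → v₂ k q + (- 1ℚ) * v₁ k q + + 1 / 6) x
        ≡⟨ carrySum-+-const k (+ 1 / 6) (λ q → v₂ k q + (- 1ℚ) * v₁ k q) x ⟩
      carrySum k (λ q → v₂ k q + (- 1ℚ) * v₁ k q) x + n * (n * Nᵉ) * (+ 1 / 6)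
        ≡⟨ cong (_+ n * (n * Nᵉ) * (+ 1 / 6)) (carrySum-lin k (- 1ℚ) (v₂ k) (v₁ k) x) ⟩
      carrySum k (v₂ k) x + (- 1ℚ) * carrySum k (v₁ k) x + n * (n * Nᵉ) * (+ 1 / 6)
        ≡⟨ cong₂ (λ u w → u + (- 1ℚ) * w + n * (n * Nᵉ) * (+ 1 / 6)) (carrySum-v₂ e x) (carrySum-v₁ (suc e) x) ⟩
      Nᵉ * v₂ k x + (- 1ℚ) * (n * Nᵉ * v₁ k x) + n * (n * Nᵉ) * (+ 1 / 6)
        ≡⟨ expand Nᵉ n (centred k x) κ ⟩
      cubic a₀ a₁ a₂ 0ℚ (centred k x) ∎
      where
      expand : ∀ Nᵉ n z κ →
        let a₀ = n * (n * Nᵉ) * (+ 1 / 6) - Nᵉ * (κ + 1ℚ) * (+ 1 / 12)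
            a₁ = - (n * Nᵉ)
            a₂ = Nᵉ
        in Nᵉ * (z * z - (κ + 1ℚ) * (+ 1 / 12)) + (- 1ℚ) * (n * Nᵉ * z) + n * (n * Nᵉ) * (+ 1 / 6)
           ≡ a₀ + a₁ * z + a₂ * (z * z) + 0ℚ * (z * z * z)
      expand = solve-∀ ℚ-ring
    summed : ∀ Nᵉ n z κ →
      let a₀ = n * (n * Nᵉ) * (+ 1 / 6) - Nᵉ * (κ + 1ℚ) * (+ 1 / 12)
          a₁ = - (n * Nᵉ)
          a₂ = Nᵉ
          S₁ = n * (n - 1ℚ) * ½
          W a b c e = n * (a + b * z + c * (z * z) + e * (z * z * z)) + S₁ * (b + ℕ→ℚ 2 * c * z + ℕ→ℚ 3 * e * (z * z))
                      + S₁ * (ℕ→ℚ 2 * n - 1ℚ) * ⅓ * (c + ℕ→ℚ 3 * e * z) + S₁ * S₁ * e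
      in W a₀ a₁ a₂ 0ℚ ≡ n * Nᵉ * (z * z - (κ + 1ℚ) * (+ 1 / 12) + (- 1ℚ) * z + + 1 / 6)
    summed = solve-∀ ℚ-ring

  carrySum-v₃ : ∀ e c → carrySum (3 ℕ.+ e) (v₃ (3 ℕ.+ e)) c ≡ ℕ→ℚ N ^ℚ e * v₃ (3 ℕ.+ e) c
  carrySum-v₃ zero    = carrySum-≗fallingFactorial 3 v₃-fallingFactorial
  carrySum-v₃ (suc e) c = begin
    carrySum (suc k) (v₃ (suc k)) c                 ≡⟨ carrySum-suc-cubic k (v₃ (suc k)) a₀ a₁ a₂ a₃ cubic-form c ⟩
    cubicWindowSum n a₀ a₁ a₂ a₃ (centred k c) ≡⟨ summed Nᵉ n (centred k c) κ ⟩
    n * Nᵉ * (v₃ k c + (- (+ 3 / 2)) * v₂ k c + ½ * v₁ k c)    ≡⟨ cong (n * Nᵉ *_) (v₃-suc k c) ⟨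
    n * Nᵉ * v₃ (suc k) c                           ∎
    where
    open ≡-Reasoning
    k : ℕ
    k = 3 ℕ.+ e
    κ n Nᵉ : ℚ
    κ = ℕ→ℚ k
    n = ℕ→ℚ N
    Nᵉ = n ^ℚ e
    a₀ a₁ a₂ a₃ : ℚ
    a₀ = (+ 3 / 2) * (n * Nᵉ) * ((κ + 1ℚ) * (+ 1 / 12))
    a₁ = n * (n * Nᵉ) * ½ - Nᵉ * ((κ + 1ℚ) * (+ 1 / 4))
    a₂ = - (+ 3 / 2) * (n * Nᵉ)
    a₃ = Nᵉ
    cubic-form : ∀ x → carrySum k (v₃ (suc k)) x ≡ cubic a₀ a₁ a₂ a₃ (centred k x)
    cubic-form x = begin
      carrySum k (v₃ (suc k)) x
        ≡⟨ carrySum-cong k (v₃-suc k) x ⟩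
      carrySum k (λ q → v₃ k q + (- (+ 3 / 2)) * v₂ k q + ½ * v₁ k q) x
        ≡⟨ carrySum-lin k ½ (λ q → v₃ k q + (- (+ 3 / 2)) * v₂ k q) (v₁ k) x ⟩
      carrySum k (λ q → v₃ k q + (- (+ 3 / 2)) * v₂ k q) x + ½ * carrySum k (v₁ k) x
        ≡⟨ cong (_+ ½ * carrySum k (v₁ k) x) (carrySum-lin k (- (+ 3 / 2)) (v₃ k) (v₂ k) x) ⟩
      carrySum k (v₃ k) x + (- (+ 3 / 2)) * carrySum k (v₂ k) x + ½ * carrySum k (v₁ k) x
        ≡⟨ cong₂ (λ u w → u + (- (+ 3 / 2)) * w + ½ * carrySum k (v₁ k) x) (carrySum-v₃ e x) (carrySum-v₂ (suc e) x) ⟩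
      Nᵉ * v₃ k x + (- (+ 3 / 2)) * (n * Nᵉ * v₂ k x) + ½ * carrySum k (v₁ k) x
        ≡⟨ cong (λ y → Nᵉ * v₃ k x + (- (+ 3 / 2)) * (n * Nᵉ * v₂ k x) + ½ * y) (carrySum-v₁ (suc (suc e)) x) ⟩
      Nᵉ * v₃ k x + (- (+ 3 / 2)) * (n * Nᵉ * v₂ k x) + ½ * (n * (n * Nᵉ) * v₁ k x)
        ≡⟨ expand Nᵉ n (centred k x) κ ⟩
      cubic a₀ a₁ a₂ a₃ (centred k x) ∎
      where
      expand : ∀ Nᵉ n z κ →
        let a₀ = (+ 3 / 2) * (n * Nᵉ) * ((κ + 1ℚ) * (+ 1 / 12))
            a₁ = n * (n * Nᵉ) * ½ - Nᵉ * ((κ + 1ℚ) * (+ 1 / 4))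
            a₂ = - (+ 3 / 2) * (n * Nᵉ)
            a₃ = Nᵉ
        in Nᵉ * (z * z * z - (κ + 1ℚ) * (+ 1 / 4) * z)
           + (- (+ 3 / 2)) * (n * Nᵉ * (z * z - (κ + 1ℚ) * (+ 1 / 12))) + ½ * (n * (n * Nᵉ) * z)
           ≡ a₀ + a₁ * z + a₂ * (z * z) + a₃ * (z * z * z)
      expand = solve-∀ ℚ-ring
    summed : ∀ Nᵉ n z κ →
      let a₀ = (+ 3 / 2) * (n * Nᵉ) * ((κ + 1ℚ) * (+ 1 / 12))
          a₁ = n * (n * Nᵉ) * ½ - Nᵉ * ((κ + 1ℚ) * (+ 1 / 4))
          a₂ = - (+ 3 / 2) * (n * Nᵉ)
          a₃ = Nᵉ
          S₁ = n * (n - 1ℚ) * ½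
          W a b c e = n * (a + b * z + c * (z * z) + e * (z * z * z)) + S₁ * (b + ℕ→ℚ 2 * c * z + ℕ→ℚ 3 * e * (z * z))
                      + S₁ * (ℕ→ℚ 2 * n - 1ℚ) * ⅓ * (c + ℕ→ℚ 3 * e * z) + S₁ * S₁ * e
      in W a₀ a₁ a₂ a₃ ≡ n * Nᵉ * (z * z * z - (κ + 1ℚ) * (+ 1 / 4) * z + (- (+ 3 / 2)) * (z * z - (κ + 1ℚ) * (+ 1 / 12)) + ½ * z)
    summed = solve-∀ ℚ-ring

module _ (N : ℕ) .{{_ : NonZero N}} where

  invPow*Nᵏ≡1 : ∀ k → invPow N k * ℕ→ℚ N ^ℚ k ≡ 1ℚ
  invPow*Nᵏ≡1 k = trans (cong (invPow N k *_) (sym (ℕ→ℚ-^ N k))) (1/n*n≡1 (N ℕ.^ k) {{ℕ.m^n≢0 N k}})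

  invPow-split : ∀ {k e j} → e ℕ.+ j ≡ k → invPow N k * ℕ→ℚ N ^ℚ e ≡ invPow N j
  invPow-split {e = e} {j} refl = begin
    invPow N (e ℕ.+ j) * Nᵉ                              ≡⟨ ℚ.*-identityʳ _ ⟨
    invPow N (e ℕ.+ j) * Nᵉ * 1ℚ                         ≡⟨ cong (invPow N (e ℕ.+ j) * Nᵉ *_) (trans (ℚ.*-comm (ℕ→ℚ N ^ℚ j) (invPow N j)) (invPow*Nᵏ≡1 j)) ⟨
    invPow N (e ℕ.+ j) * Nᵉ * (ℕ→ℚ N ^ℚ j * invPow N j)  ≡⟨ regroup (invPow N (e ℕ.+ j)) Nᵉ (ℕ→ℚ N ^ℚ j) (invPow N j) ⟩
    invPow N (e ℕ.+ j) * (Nᵉ * ℕ→ℚ N ^ℚ j) * invPow N j  ≡⟨ cong (λ x → invPow N (e ℕ.+ j) * x * invPow N j) (^ℚ-+ (ℕ→ℚ N) e j) ⟨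
    invPow N (e ℕ.+ j) * ℕ→ℚ N ^ℚ (e ℕ.+ j) * invPow N j ≡⟨ cong (_* invPow N j) (invPow*Nᵏ≡1 (e ℕ.+ j)) ⟩
    1ℚ * invPow N j                                      ≡⟨ ℚ.*-identityˡ (invPow N j) ⟩
    invPow N j                                           ∎
    where
    open ≡-Reasoning
    Nᵉ : ℚ
    Nᵉ = ℕ→ℚ N ^ℚ e
    regroup : ∀ a b c d → a * b * (c * d) ≡ a * (b * c) * d
    regroup = solve-∀ ℚ-ring

  invPow-cancel : ∀ {k e j} → e ℕ.+ j ≡ k → ∀ {x y} → invPow N k * x ≡ invPow N j * y → x ≡ ℕ→ℚ N ^ℚ e * y
  invPow-cancel {k} {e} {j} e+j≡k {x} {y} eq = begin
    x                                       ≡⟨ ℚ.*-identityˡ x ⟨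
    1ℚ * x                                  ≡⟨ cong (_* x) (trans (ℚ.*-comm (ℕ→ℚ N ^ℚ k) (invPow N k)) (invPow*Nᵏ≡1 k)) ⟨
    ℕ→ℚ N ^ℚ k * invPow N k * x             ≡⟨ ℚ.*-assoc (ℕ→ℚ N ^ℚ k) (invPow N k) x ⟩
    ℕ→ℚ N ^ℚ k * (invPow N k * x)           ≡⟨ cong₂ _*_ (trans (cong (ℕ→ℚ N ^ℚ_) (sym e+j≡k)) (^ℚ-+ (ℕ→ℚ N) e j)) eq ⟩
    Nᵉ * ℕ→ℚ N ^ℚ j * (invPow N j * y)      ≡⟨ regroup Nᵉ (ℕ→ℚ N ^ℚ j) (invPow N j) y ⟩
    Nᵉ * (invPow N j * ℕ→ℚ N ^ℚ j * y)      ≡⟨ cong (λ z → Nᵉ * (z * y)) (invPow*Nᵏ≡1 j) ⟩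
    Nᵉ * (1ℚ * y)                           ≡⟨ cong (Nᵉ *_) (ℚ.*-identityˡ y) ⟩
    Nᵉ * y                                  ∎
    where
    open ≡-Reasoning
    Nᵉ : ℚ
    Nᵉ = ℕ→ℚ N ^ℚ e
    regroup : ∀ a b c d → a * b * (c * d) ≡ a * (c * b * d)
    regroup = solve-∀ ℚ-ring

module Eigenvectors (N : ℕ) .{{_ : NonZero N}} (1<N : 1 < N) where

  open CarrySum N

  IsEigenOn : ℕ → ℕ → (ℕ → ℚ) → Set
  IsEigenOn k e u = ∀ c → c < k → carrySum k u c ≡ ℕ→ℚ N ^ℚ e * u c

  eigen-Δⁿ : ∀ {e} r s u {a} → IsEigenOn (r ℕ.+ suc s) e u → (∀ q → q < suc s → Δⁿ r u q ≡ a) →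
             ℕ→ℚ N ^ℚ suc s * a ≡ ℕ→ℚ N ^ℚ e * a
  eigen-Δⁿ {e} r s u {a} eigen Δʳu≡a = begin
    ℕ→ℚ N ^ℚ suc s * a                   ≡⟨ carrySum-const (suc s) a 0 ⟨
    carrySum (suc s) (λ _ → a) 0         ≡⟨ carrySum-local (suc s) 0 (s≤s z≤n) (λ q q<s → sym (Δʳu≡a q q<s)) ⟩
    carrySum (suc s) (Δⁿ r u) 0          ≡⟨ Δⁿ-carrySum r (suc s) u 0 ⟨
    Δⁿ r (carrySum (r ℕ.+ suc s) u) 0    ≡⟨ Δⁿ-local r (λ c c≤r → eigen c (ℕ.≤-<-trans c≤r (ℕ.m<m+n r (s≤s z≤n)))) ⟩
    Δⁿ r (λ c → ℕ→ℚ N ^ℚ e * u c) 0      ≡⟨ Δⁿ-scale r (ℕ→ℚ N ^ℚ e) u 0 ⟩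
    ℕ→ℚ N ^ℚ e * Δⁿ r u 0                ≡⟨ cong (ℕ→ℚ N ^ℚ e *_) (Δʳu≡a 0 (s≤s z≤n)) ⟩
    ℕ→ℚ N ^ℚ e * a                       ∎
    where open ≡-Reasoning

  eigen-vanishes : ∀ {k e j} → e ℕ.+ j ≡ k → ∀ u → IsEigenOn k e u → Δⁿ j u 0 ≡ 0ℚ → ∀ c → c < k → u c ≡ 0ℚ
  eigen-vanishes {k} {e} {j} e+j≡k u eigen Δʲu≡0 c c<k =
    level 0 k refl c (subst (_< k) (sym (ℕ.+-identityʳ c)) c<k)
    where
    level : ∀ r s → r ℕ.+ s ≡ k → ∀ c → c ℕ.+ r < k → Δⁿ r u c ≡ 0ℚ
    level r zero    r+0≡k c c+r<k =
      ⊥-elim (ℕ.<⇒≱ c+r<k (ℕ.≤-trans (ℕ.≤-reflexive (trans (sym r+0≡k) (ℕ.+-identityʳ r))) (ℕ.m≤n+m r c)))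
    level r (suc s) r+s≡k c c+r<k = trans (constant c c+r<k) bottom
      where
      constant : ∀ c → c ℕ.+ r < k → Δⁿ r u c ≡ Δⁿ r u 0
      constant = Δⁿ-constant r k u (level (suc r) s (trans (sym (ℕ.+-suc r s)) r+s≡k))
      bottom : Δⁿ r u 0 ≡ 0ℚ
      bottom with r ℕ.≟ j
      ... | yes refl = Δʲu≡0
      ... | no  r≢j  = x*a≡y*a∧x≢y⇒a≡0 (ℕ→ℚ N ^ℚ suc s) (ℕ→ℚ N ^ℚ e) (Δⁿ r u 0)
                         (eigen-Δⁿ {e} r s u (subst (λ K → IsEigenOn K e u) (sym r+s≡k) eigen)
                                   (λ q q<s → constant q (subst (q ℕ.+ r <_) r+s≡k (subst (_< r ℕ.+ suc s) (ℕ.+-comm r q) (ℕ.+-monoʳ-< r q<s)))))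
                         (λ Nˢ≡Nᵉ → r≢j (ℕ.+-cancelʳ-≡ (suc s) r j (begin
                           r ℕ.+ suc s ≡⟨ r+s≡k ⟩
                           k           ≡⟨ e+j≡k ⟨
                           e ℕ.+ j     ≡⟨ cong (ℕ._+ j) (^ℚ-injective 1<N Nˢ≡Nᵉ) ⟨
                           suc s ℕ.+ j ≡⟨ ℕ.+-comm (suc s) j ⟩
                           j ℕ.+ suc s ∎)))
        where open ≡-Reasoning

  eigen-proportional : ∀ {k e j} → e ℕ.+ j ≡ k → ∀ u v → IsEigenOn k e u → IsEigenOn k e v →
                       Δⁿ j v 0 ≢ 0ℚ → Σ ℚ λ τ → ∀ c → c < k → u c ≡ τ * v c
  eigen-proportional {k} {e} {j} e+j≡k u v u-eigen v-eigen Δʲv≢0 = τ , u≡τv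
    where
    instance
      Δʲv-nonZero : ℚ.NonZero (Δⁿ j v 0)
      Δʲv-nonZero = ℚ.≢-nonZero Δʲv≢0
    τ : ℚ
    τ = Δⁿ j u 0 * 1/ (Δⁿ j v 0)
    w : ℕ → ℚ
    w q = u q + (- τ) * v q
    w-eigen : IsEigenOn k e w
    w-eigen c c<k = begin
      carrySum k w c                                        ≡⟨ carrySum-lin k (- τ) u v c ⟩
      carrySum k u c + (- τ) * carrySum k v c               ≡⟨ cong₂ (λ x y → x + (- τ) * y) (u-eigen c c<k) (v-eigen c c<k) ⟩
      ℕ→ℚ N ^ℚ e * u c + (- τ) * (ℕ→ℚ N ^ℚ e * v c)         ≡⟨ factor (ℕ→ℚ N ^ℚ e) (u c) (v c) τ ⟩
      ℕ→ℚ N ^ℚ e * w c                                      ∎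
      where
      open ≡-Reasoning
      factor : ∀ Nᵉ x y t → Nᵉ * x + (- t) * (Nᵉ * y) ≡ Nᵉ * (x + (- t) * y)
      factor = solve-∀ ℚ-ring
    Δʲw≡0 : Δⁿ j w 0 ≡ 0ℚ
    Δʲw≡0 = begin
      Δⁿ j w 0                                              ≡⟨ Δⁿ-lin j (- τ) u v 0 ⟩
      Δⁿ j u 0 + (- (Δⁿ j u 0 * 1/ (Δⁿ j v 0))) * Δⁿ j v 0  ≡⟨ cancel (Δⁿ j u 0) (1/ (Δⁿ j v 0)) (Δⁿ j v 0) ⟩
      Δⁿ j u 0 - Δⁿ j u 0 * (1/ (Δⁿ j v 0) * Δⁿ j v 0)      ≡⟨ cong (λ x → Δⁿ j u 0 - Δⁿ j u 0 * x) (ℚ.*-inverseˡ (Δⁿ j v 0)) ⟩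
      Δⁿ j u 0 - Δⁿ j u 0 * 1ℚ                              ≡⟨ x-x*1≡0 (Δⁿ j u 0) ⟩
      0ℚ                                                    ∎
      where
      open ≡-Reasoning
      cancel : ∀ a b c → a + (- (a * b)) * c ≡ a - a * (b * c)
      cancel = solve-∀ ℚ-ring
      x-x*1≡0 : ∀ x → x - x * 1ℚ ≡ 0ℚ
      x-x*1≡0 = solve-∀ ℚ-ring
    u≡τv : ∀ c → c < k → u c ≡ τ * v c
    u≡τv c c<k = begin
      u c                       ≡⟨ split (u c) (v c) τ ⟩
      w c + τ * v c             ≡⟨ cong (_+ τ * v c) (eigen-vanishes {k} {e} {j} e+j≡k w w-eigen Δʲw≡0 c c<k) ⟩
      0ℚ + τ * v c              ≡⟨ ℚ.+-identityˡ (τ * v c) ⟩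
      τ * v c                   ∎
      where
      open ≡-Reasoning
      split : ∀ x y t → x ≡ x + (- t) * y + t * y
      split = solve-∀ ℚ-ring

  normEigen⇒eigenOn : ∀ {m e j} → e ℕ.+ j ≡ suc m → ∀ v → IsNormEigen N m j v →
                      IsEigenOn (suc m) e (extend (suc m) v)
  normEigen⇒eigenOn {m} {e} {j} e+j≡k v (_ , v-eigen) c c<k =
    subst (λ x → carrySum (suc m) (extend (suc m) v) x ≡ ℕ→ℚ N ^ℚ e * extend (suc m) v x) (Fin.toℕ-fromℕ< c<k)
      (invPow-cancel N {suc m} {e} {j} e+j≡k (begin
        invPow N (suc m) * carrySum (suc m) (extend (suc m) v) (toℕ i)  ≡⟨ P-carrySum (suc m) v i ⟨
        Σℚ (suc m) (λ c′ → P N (suc m) i c′ * v c′)                     ≡⟨ v-eigen i ⟩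
        invPow N j * v i                                                ≡⟨ cong (invPow N j *_) (extend-toℕ (suc m) v i) ⟨
        invPow N j * extend (suc m) v (toℕ i)                           ∎))
    where
    open ≡-Reasoning
    i : Fin (suc m)
    i = Fin.fromℕ< c<k

  eigenOn⇒normEigen : ∀ {m e j} → e ℕ.+ j ≡ suc m → ∀ v → IsEigenOn (suc m) e v → ∀ {ρ} → v 0 * ρ ≡ 1ℚ →
                      IsNormEigen N m j (λ i → ρ * v (toℕ i))
  eigenOn⇒normEigen {m} {e} {j} e+j≡k v v-eigen {ρ} v0ρ≡1 = trans (ℚ.*-comm ρ (v 0)) v0ρ≡1 , λ c → begin
    Σℚ (suc m) (λ c′ → P N (suc m) c c′ * (ρ * v (toℕ c′)))
      ≡⟨ P-carrySum (suc m) (λ i → ρ * v (toℕ i)) c ⟩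
    invPow N (suc m) * carrySum (suc m) (extend (suc m) (λ i → ρ * v (toℕ i))) (toℕ c)
      ≡⟨ cong (invPow N (suc m) *_) (carrySum-local (suc m) (toℕ c) (Fin.toℕ<n c) (extend-restrict (suc m) (λ q → ρ * v q))) ⟩
    invPow N (suc m) * carrySum (suc m) (λ q → ρ * v q) (toℕ c)
      ≡⟨ cong (invPow N (suc m) *_) (trans (carrySum-scale (suc m) ρ v (toℕ c)) (cong (ρ *_) (v-eigen (toℕ c) (Fin.toℕ<n c)))) ⟩
    invPow N (suc m) * (ρ * (ℕ→ℚ N ^ℚ e * v (toℕ c)))
      ≡⟨ regroup (invPow N (suc m)) ρ (ℕ→ℚ N ^ℚ e) (v (toℕ c)) ⟩
    invPow N (suc m) * ℕ→ℚ N ^ℚ e * (ρ * v (toℕ c))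
      ≡⟨ cong (_* (ρ * v (toℕ c))) (invPow-split N {suc m} {e} {j} e+j≡k) ⟩
    invPow N j * (ρ * v (toℕ c)) ∎
    where
    open ≡-Reasoning
    regroup : ∀ a r b x → a * (r * (b * x)) ≡ a * b * (r * x)
    regroup = solve-∀ ℚ-ring

  eigen-genPoly : ∀ {m e j} → e ℕ.+ j ≡ suc m → ∀ v → IsEigenOn (suc m) e v → Δⁿ j v 0 ≢ 0ℚ →
                  ∀ {ρ} → v 0 * ρ ≡ 1ℚ → ∀ (G : ℚ → ℚ) → (∀ x → binomialSum x m v ≡ v 0 * G x) →
                  Σ (Fin (suc m) → ℚ) (IsNormEigen N m j) ×
                  (∀ w → IsNormEigen N m j w → ∀ x → genPoly (suc m) w x ≡ G x)
  eigen-genPoly {m} {e} {j} e+j≡k v v-eigen Δʲv≢0 {ρ} v0ρ≡1 G binomial-v =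
    ((λ i → ρ * v (toℕ i)) , eigenOn⇒normEigen {m} {e} {j} e+j≡k v v-eigen v0ρ≡1) , genPoly≡G
    where
    genPoly≡G : ∀ w → IsNormEigen N m j w → ∀ x → genPoly (suc m) w x ≡ G x
    genPoly≡G w w-norm@(w0≡1 , _) x = begin
      Σℚ (suc m) (λ i → ℕ→ℚ (m C toℕ i) * w i * x ^ℚ toℕ i)
        ≡⟨ Σℚ-cong (suc m) (λ i → cong (λ y → ℕ→ℚ (m C toℕ i) * y * x ^ℚ toℕ i) (w≡τv i)) ⟩
      Σℚ (suc m) (λ i → ℕ→ℚ (m C toℕ i) * (τ * v (toℕ i)) * x ^ℚ toℕ i)
        ≡⟨ Σℚ-∑ (suc m) (λ i → ℕ→ℚ (m C i) * (τ * v i) * x ^ℚ i) ⟩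
      binomialSum x m (λ i → τ * v i)
        ≡⟨ binomialSum-scale x m τ v ⟩
      τ * binomialSum x m v
        ≡⟨ cong (τ *_) (binomial-v x) ⟩
      τ * (v 0 * G x)
        ≡⟨ ℚ.*-assoc τ (v 0) (G x) ⟨
      τ * v 0 * G x
        ≡⟨ cong (_* G x) τv0≡1 ⟩
      1ℚ * G x
        ≡⟨ ℚ.*-identityˡ (G x) ⟩
      G x ∎
      where
      open ≡-Reasoning
      proportional : Σ ℚ λ τ → ∀ c → c < suc m → extend (suc m) w c ≡ τ * v c
      proportional = eigen-proportional {suc m} {e} {j} e+j≡k (extend (suc m) w) v
                       (normEigen⇒eigenOn {m} {e} {j} e+j≡k w w-norm) v-eigen Δʲv≢0
      τ : ℚ
      τ = proj₁ proportional
      w≡τv : ∀ i → w i ≡ τ * v (toℕ i)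
      w≡τv i = trans (sym (extend-toℕ (suc m) w i)) (proj₂ proportional (toℕ i) (Fin.toℕ<n i))
      τv0≡1 : τ * v 0 ≡ 1ℚ
      τv0≡1 = trans (sym (w≡τv Fin.zero)) w0≡1

module Quotients (N : ℕ) .{{_ : NonZero N}} (1<N : 1 < N) where

  open CarrySum N
  open Eigenvectors N 1<N

  quotient₂ : (m : ℕ) → 4 ≤ suc m →
    Σ (Fin (suc m) → ℚ) (λ v → IsNormEigen N m 2 v) ×
    ((v : Fin (suc m) → ℚ) → IsNormEigen N m 2 v →
      (x : ℚ) → genPoly (suc m) v x ≡ ((1ℚ + x) ^ℚ (suc m ∸ 3)) * Q2 (suc m) x)
  quotient₂ (suc (suc (suc t))) _ =
    eigen-genPoly {3 ℕ.+ t} {2 ℕ.+ t} {2} (ℕ.+-comm (2 ℕ.+ t) 2) (v₂ (4 ℕ.+ t)) (λ c _ → carrySum-v₂ (2 ℕ.+ t) c)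
      (λ Δ²≡0 → case trans (sym (Δ²v₂≡2 (4 ℕ.+ t))) Δ²≡0 of λ ())
      (v₂-0-inverse t) (λ x → (1ℚ + x) ^ℚ suc t * Q2 (4 ℕ.+ t) x) (binomialSum-v₂ t)
  quotient₂ 0 (s≤s ())
  quotient₂ 1 (s≤s (s≤s ()))
  quotient₂ 2 (s≤s (s≤s (s≤s ())))

  quotient₃ : (m : ℕ) → 5 ≤ suc m →
    Σ (Fin (suc m) → ℚ) (λ v → IsNormEigen N m 3 v) ×
    ((v : Fin (suc m) → ℚ) → IsNormEigen N m 3 v →
      (x : ℚ) → genPoly (suc m) v x ≡ ((1ℚ + x) ^ℚ (suc m ∸ 4)) * Q3 (suc m) x)
  quotient₃ (suc (suc (suc (suc t)))) _ =
    eigen-genPoly {4 ℕ.+ t} {2 ℕ.+ t} {3} (ℕ.+-comm (2 ℕ.+ t) 3) (v₃ (5 ℕ.+ t)) (λ c _ → carrySum-v₃ (2 ℕ.+ t) c)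
      (λ Δ³≡0 → case trans (sym (Δ³v₃≡6 (5 ℕ.+ t))) Δ³≡0 of λ ())
      (v₃-0-inverse t) (λ x → (1ℚ + x) ^ℚ suc t * Q3 (5 ℕ.+ t) x) (binomialSum-v₃ t)
  quotient₃ 0 (s≤s ())
  quotient₃ 1 (s≤s (s≤s ()))
  quotient₃ 2 (s≤s (s≤s (s≤s ())))
  quotient₃ 3 (s≤s (s≤s (s≤s (s≤s ()))))

proposition4p5 : (N : ℕ) .{{_ : NonZero N}} → 2 ≤ N →
    ((m : ℕ) → 4 ≤ suc m →
      Σ (Fin (suc m) → ℚ) (λ v → IsNormEigen N m 2 v) ×
      ((v : Fin (suc m) → ℚ) → IsNormEigen N m 2 v →
        (x : ℚ) → genPoly (suc m) v x ≡ ((1ℚ + x) ^ℚ (suc m ∸ 3)) * Q2 (suc m) x)) ×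
    ((m : ℕ) → 5 ≤ suc m →
      Σ (Fin (suc m) → ℚ) (λ v → IsNormEigen N m 3 v) ×
      ((v : Fin (suc m) → ℚ) → IsNormEigen N m 3 v →
        (x : ℚ) → genPoly (suc m) v x ≡ ((1ℚ + x) ^ℚ (suc m ∸ 4)) * Q3 (suc m) x))
proposition4p5 N 2≤N = quotient₂ , quotient₃
  where open Quotients N 2≤N
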